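{- Let $M=(V,D)$ be a vf-closed $\Delta$-matroid and $n=|V|$. If $M$ is strongly divisible by $u\in V$, then \[Q_1(M)=Q_1(M\setminus u)+Q_1(M*u\setminus u)+Q_1(M\,\bar{*}\,u\setminus u).\] If $M$ is not strongly divisible, then $Q_1(M)=(y+2)^n$.
   Context: A set system is $M=(V,D)$ with $V$ finite, $D$ a family of subsets of $V$; write $Z\in M$ for $Z\in D$; proper means $D\neq\emptyset$. $\oplus$ is symmetric difference. Pivot: $M*X=(V,\{Z\oplus X:Z\in D\})$; loop complementation: $M+w=(V,D\oplus\{Z\cup\{w\}:Z\in D,w\notin Z\})$; operations are applied left to right; dual pivot $M\,\bar{*}\,w=M+w*w+w$; operations on distinct elements commute, and $M\,\bar{*}\,X$ denotes applying $\bar{*}\,w$ for all $w\in X$. $M\setminus u=(V\setminus\{u\},\{Z\in D:u\notin Z\})$. For proper $M$, $d_M(X)=\min\{|X\oplus Z|:Z\in M\}$, $d_M=d_M(\emptyset)$, and $Q_1(M)=\sum_{X,Y\subseteq V,\,X\cap Y=\emptyset}y^{d_{M*Y\,\bar{*}\,X}}$. A $\Delta$-matroid is a proper set system such that for all $X,Y\in M$ and $w\in X\oplus Y$, either $X\oplus\{w\}\in M$ or some $v\in X\oplus Y$, $v\neq w$, has $X\oplus\{w,v\}\in M$. $M$ is a vf-closed $\Delta$-matroid if $M\varphi$ is a $\Delta$-matroid for every sequence $\varphi$ of pivots and loop complementations on elements of $V$. $M$ is divisible by $u$ if some $X_1,X_2\in M$ have $u\in X_1\oplus X_2$; strongly divisible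 by $u$ if moreover some $X\in M$ has $X\oplus\{u\}\notin M$; strongly divisible if strongly divisible by some $u\in V$. -}

module Defs where

open import Data.Nat using (ℕ; zero; suc; _+_; _^_; _⊓_)
open import Data.Bool using (Bool; true; false; _∧_; _∨_; _xor_; not; if_then_else_)
open import Data.Fin using (Fin)
open import Data.Fin.Subset using (Subset; ⁅_⁆; _∈_; _∉_; _⊆_; _∩_; _∪_; _-_; ∣_∣; ⊥; inside; outside)
open import Data.Vec using (Vec; []; _∷_; zipWith; lookup)
open import Data.List using (List; []; _∷_; map; concatMap; foldr; filter; allFin)
open import Data.Nat.ListAction using (sum)
open import Data.List.Relation.Unary.All using (All)
open import Data.Product using (Σ; ∃; _×_; _,_)
open import Data.Sum using (_⊎_)
open import Relation.Binary.PropositionalEquality using (_≡_; _≢_)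
open import Relation.Nullary using (¬_)

_⊕_ : ∀ {n} → Subset n → Subset n → Subset n
_⊕_ = zipWith _xor_

infixl 6 _⊕_

_∈ᵇ_ : ∀ {n} → Fin n → Subset n → Bool
i ∈ᵇ X = lookup X i

allTrue : ∀ {n} → Vec Bool n → Bool
allTrue [] = true
allTrue (b ∷ bs) = b ∧ allTrue bs

_⊆ᵇ_ : ∀ {n} → Subset n → Subset n → Bool
X ⊆ᵇ Y = allTrue (zipWith (λ a b → not a ∨ b) X Y)

disjointᵇ : ∀ {n} → Subset n → Subset n → Bool
disjointᵇ X Y = allTrue (zipWith (λ a b → not (a ∧ b)) X Y)

allSubsets : (n : ℕ) → List (Subset n)
allSubsets zero = [] ∷ []
allSubsets (suc n) = concatMap (λ s → (outside ∷ s) ∷ (inside ∷ s) ∷ []) (allSubsets n)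

-- A set system M = (V, D): the ground set V is a subset of an ambient Fin n,
-- the family D is given by its (decidable) characteristic function, and every
-- member of D is a subset of V.
record SetSystem (n : ℕ) : Set where
  constructor mkSS
  field
    V  : Subset n
    D  : Subset n → Bool
    D⊆V : ∀ Z → D Z ≡ true → Z ⊆ V
open SetSystem public

_∈M_ : ∀ {n} → Subset n → SetSystem n → Set
Z ∈M M = D M Z ≡ true

Proper : ∀ {n} → SetSystem n → Set
Proper M = ∃ λ Z → Z ∈M M

pivotD : ∀ {n} → (Subset n → Bool) → Subset n → (Subset n → Bool)
pivotD d X Z = d (Z ⊕ X)

-- Loop complementation M + w :
-- D ⊕ { Z ∪ {w} : Z ∈ D, w ∉ Z }.  A set Z' is in the second family iff
-- w ∈ Z' and Z' - w ∈ D.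
loopD : ∀ {n} → (Subset n → Bool) → Fin n → (Subset n → Bool)
loopD d w Z = d Z xor (w ∈ᵇ Z ∧ d (Z - w))

delD : ∀ {n} → (Subset n → Bool) → Fin n → (Subset n → Bool)
delD d u Z = d Z ∧ not (u ∈ᵇ Z)

-- Well-formedness (members ⊆ V) is not needed for computing Q₁; we keep the
-- operations on raw (V , D) pairs.
RawSS : ℕ → Set
RawSS n = Subset n × (Subset n → Bool)

raw : ∀ {n} → SetSystem n → RawSS n
raw M = V M , D M

_*ᵖ_ : ∀ {n} → RawSS n → Subset n → RawSS n
(v , d) *ᵖ X = v , pivotD d X

_+ₗ_ : ∀ {n} → RawSS n → Fin n → RawSS n
(v , d) +ₗ w = v , loopD d w

_∖_ : ∀ {n} → RawSS n → Fin n → RawSS n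
(v , d) ∖ u = (v - u) , delD d u

infixl 5 _*ᵖ_ _+ₗ_ _∖_ _*̄_ _*̄ˢ_

_*̄_ : ∀ {n} → RawSS n → Fin n → RawSS n
M *̄ w = M +ₗ w *ᵖ ⁅ w ⁆ +ₗ w

_*̄ˢ_ : ∀ {n} → RawSS n → Subset n → RawSS n
M *̄ˢ X = foldr (λ w N → if w ∈ᵇ X then N *̄ w else N) M (allFin _)

-- d_M = min { |Z| : Z ∈ M }  (the default n never changes the minimum
-- for a proper M, since |Z| ≤ n).
dist : ∀ {n} → RawSS n → ℕ
dist {n} (v , d) = foldr (λ Z m → if d Z then ∣ Z ∣ ⊓ m else m) n (allSubsets n)

Q₁ : ∀ {n} → RawSS n → ℕ → ℕ
Q₁ {n} (v , d) y =
  sum (concatMap (λ X → map (λ Y →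
         if (X ⊆ᵇ v) ∧ (Y ⊆ᵇ v) ∧ disjointᵇ X Y
           then y ^ dist ((v , d) *ᵖ Y *̄ˢ X)
           else 0)
       (allSubsets n)) (allSubsets n))

IsΔMatroid : ∀ {n} → RawSS n → Set
IsΔMatroid {n} (v , d) =
  (∃ λ Z → d Z ≡ true) ×
  (∀ X Y → d X ≡ true → d Y ≡ true → ∀ w → w ∈ (X ⊕ Y) →
     d (X ⊕ ⁅ w ⁆) ≡ true ⊎
     (∃ λ u → u ∈ (X ⊕ Y) × u ≢ w × d (X ⊕ (⁅ w ⁆ ∪ ⁅ u ⁆)) ≡ true))

data ElemOp (n : ℕ) : Set where
  piv  : Fin n → ElemOp n
  loop : Fin n → ElemOp n

opElem : ∀ {n} → ElemOp n → Fin n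
opElem (piv w) = w
opElem (loop w) = w

applyOp : ∀ {n} → RawSS n → ElemOp n → RawSS n
applyOp M (piv w) = M *ᵖ ⁅ w ⁆
applyOp M (loop w) = M +ₗ w

applySeq : ∀ {n} → RawSS n → List (ElemOp n) → RawSS n
applySeq M [] = M
applySeq M (o ∷ os) = applySeq (applyOp M o) os

VfClosedΔMatroid : ∀ {n} → SetSystem n → Set
VfClosedΔMatroid {n} M =
  ∀ (φ : List (ElemOp n)) → All (λ o → opElem o ∈ V M) φ →
    IsΔMatroid (applySeq (raw M) φ)

DivisibleBy : ∀ {n} → SetSystem n → Fin n → Set
DivisibleBy M u = ∃ λ X₁ → ∃ λ X₂ → X₁ ∈M M × X₂ ∈M M × u ∈ (X₁ ⊕ X₂)

StronglyDivisibleBy : ∀ {n} → SetSystem n → Fin n → Set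
StronglyDivisibleBy M u =
  DivisibleBy M u × (∃ λ X → X ∈M M × ¬ ((X ⊕ ⁅ u ⁆) ∈M M))

StronglyDivisible : ∀ {n} → SetSystem n → Set
StronglyDivisible M = ∃ λ u → u ∈ V M × StronglyDivisibleBy M u

module Submission where

-- Fix u and group the pairs
-- (X , Y), (X , Y ∪ u), (X ∪ u , Y) with u ∉ X ∪ Y (u cannot lie in both). Since pivots and dual
-- pivots on distinct elements commute, the three systems are N, N * u and N *̄ u for N = M * Y *̄ X,
-- and N arises from M by operations away from u.
--
-- If M is strongly divisible by u, so is N, hence each of N, N * u, N *̄ u has a member avoiding u.
-- They are Δ-matroids (M is vf-closed), and the exchange axiom then turns a minimum member containing
-- u into one avoiding u of the same size, so deleting u keeps the distance: the three terms are the
-- (X , Y) terms of Q₁ (M ∖ u), Q₁ (M * u ∖ u) and Q₁ (M *̄ u ∖ u).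
--
-- Otherwise every u is free (the family is closed under ⊕ u), a loop or a coloop, and this again
-- passes to N. In each case the three distances are e, e and e + 1 in some order, where e is the
-- distance of the corresponding term for a system of the same kind on V ∖ u, so deleting the elements
-- one by one contributes a factor y + 2 each.

open import Defs
open import Data.Nat using (ℕ; zero; suc; _+_; _*_; _^_; _≤_; _⊓_; s≤s)
open import Data.Nat.Properties
  using (+-comm; +-identityʳ; *-zeroʳ; *-distribˡ-+; ≤-trans; ≤-refl; ≤-antisym; ≤-reflexive; n≤1+n;
         m⊓n≤m; m⊓n≤n; ⊓-sel; n≤0⇒n≡0; 1+n≰n; suc-injective)
open import Data.Nat.Tactic.RingSolver using (solve-∀)
open import Data.Nat.ListAction using (sum)
open import Data.Nat.ListAction.Properties using (sum-++)
open import Data.Bool using (Bool; true; false; _∧_; _∨_; _xor_; not; if_then_else_)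
import Data.Bool as Bool
open import Data.Bool.Properties
  using (xor-assoc; xor-comm; xor-same; xor-identityʳ; ∧-zeroʳ; ∧-identityʳ; ∧-conicalˡ; ∧-conicalʳ;
         not-injective; not-¬; ¬-not)
open import Data.Bool.Solver using (module xor-∧-Solver)
open import Data.Fin using (Fin; zero; suc)
open import Data.Fin.Properties using (_≟_)
open import Data.Fin.Subset using (Subset; ⁅_⁆; _∈_; ∣_∣; ⊥; _-_; _∪_; inside; outside)
open import Data.Fin.Subset.Properties using (anySubset?; ∣p∣≤n; ∣⊥∣≡0; p─⊥≡p; p─x─y≡p─y─x)
open import Data.Vec using ([]; _∷_; lookup)
open import Data.Vec.Properties
  using (lookup⇒[]=; []=⇒lookup; lookup-zipWith; lookup-replicate; tabulate∘lookup; tabulate-cong)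
open import Data.List using (List; []; _∷_; _++_; foldr; map; concatMap; allFin)
open import Data.List.Properties using (map-concatMap)
open import Data.List.Relation.Unary.Any using (here; there)
open import Data.List.Relation.Unary.All using (All; []; _∷_)
import Data.List.Relation.Unary.All as All
open import Data.List.Relation.Unary.All.Properties using (++⁺)
open import Data.List.Relation.Unary.AllPairs using (_∷_)
open import Data.List.Relation.Unary.Unique.Propositional using (Unique)
open import Data.List.Relation.Unary.Unique.Propositional.Properties using (allFin⁺)
open import Data.List.Membership.Propositional using () renaming (_∈_ to _∈ˡ_)
open import Data.List.Membership.Propositional.Properties using (∈-allFin)
open import Data.Product using (∃; _×_; _,_; proj₁; proj₂)
open import Data.Sum using (_⊎_; inj₁; inj₂)
open import Data.Empty using (⊥-elim) renaming (⊥ to Empty)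
open import Function using (_∘_; id)
open import Relation.Binary.PropositionalEquality
  using (_≡_; _≢_; refl; sym; trans; cong; cong₂; subst; ≢-sym; module ≡-Reasoning)
open import Relation.Nullary using (¬_; ¬?; Dec; yes; no)
open import Relation.Nullary.Decidable using (decidable-stable)

open xor-∧-Solver using (solve; _:+_; _:*_; _:=_; con)

-- Subsets

subset-ext : ∀ {n} {A B : Subset n} → (∀ i → lookup A i ≡ lookup B i) → A ≡ B
subset-ext {A = A} {B} h = trans (sym (tabulate∘lookup A)) (trans (tabulate-cong h) (tabulate∘lookup B))

lookup-⊕ : ∀ {n} (A B : Subset n) i → lookup (A ⊕ B) i ≡ lookup A i xor lookup B i
lookup-⊕ A B i = lookup-zipWith _xor_ i A B

lookup-⁅⁆-self : ∀ {n} (u : Fin n) → lookup ⁅ u ⁆ u ≡ true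
lookup-⁅⁆-self zero = refl
lookup-⁅⁆-self (suc u) = lookup-⁅⁆-self u

lookup-⁅⁆-other : ∀ {n} (u : Fin n) {i} → i ≢ u → lookup ⁅ u ⁆ i ≡ false
lookup-⁅⁆-other zero {zero} i≢u = ⊥-elim (i≢u refl)
lookup-⁅⁆-other zero {suc i} _ = lookup-replicate i false
lookup-⁅⁆-other (suc u) {zero} _ = refl
lookup-⁅⁆-other (suc u) {suc i} i≢u = lookup-⁅⁆-other u (λ i≡u → i≢u (cong suc i≡u))

module _ {n} (Z : Subset n) (u : Fin n) where

  lookup-⊕⁅⁆-self : lookup (Z ⊕ ⁅ u ⁆) u ≡ not (lookup Z u)
  lookup-⊕⁅⁆-self rewrite lookup-⊕ Z ⁅ u ⁆ u | lookup-⁅⁆-self u with lookup Z u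
  ... | true = refl
  ... | false = refl

  lookup-⊕⁅⁆-other : ∀ {i} → i ≢ u → lookup (Z ⊕ ⁅ u ⁆) i ≡ lookup Z i
  lookup-⊕⁅⁆-other {i} i≢u rewrite lookup-⊕ Z ⁅ u ⁆ i | lookup-⁅⁆-other u i≢u with lookup Z i
  ... | true = refl
  ... | false = refl

  lookup-∪⁅⁆-self : lookup (Z ∪ ⁅ u ⁆) u ≡ true
  lookup-∪⁅⁆-self rewrite lookup-zipWith _∨_ u Z ⁅ u ⁆ | lookup-⁅⁆-self u with lookup Z u
  ... | true = refl
  ... | false = refl

  lookup-∪⁅⁆-other : ∀ {i} → i ≢ u → lookup (Z ∪ ⁅ u ⁆) i ≡ lookup Z i
  lookup-∪⁅⁆-other {i} i≢u rewrite lookup-zipWith _∨_ i Z ⁅ u ⁆ | lookup-⁅⁆-other u i≢u with lookup Z i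
  ... | true = refl
  ... | false = refl

  lookup-minus-self : lookup (Z - u) u ≡ false
  lookup-minus-self = minus-self Z u
    where
    minus-self : ∀ {m} (Z : Subset m) u → lookup (Z - u) u ≡ false
    minus-self (_ ∷ _) zero = refl
    minus-self (_ ∷ Z) (suc u) = minus-self Z u

  lookup-minus-other : ∀ {i} → i ≢ u → lookup (Z - u) i ≡ lookup Z i
  lookup-minus-other = minus-other Z u
    where
    minus-other : ∀ {m} (Z : Subset m) u {i} → i ≢ u → lookup (Z - u) i ≡ lookup Z i
    minus-other (_ ∷ Z) zero {zero} i≢u = ⊥-elim (i≢u refl)
    minus-other (_ ∷ Z) zero {suc i} _ = cong (λ W → lookup W i) (p─⊥≡p Z)
    minus-other (_ ∷ Z) (suc u) {zero} _ = refl
    minus-other (_ ∷ Z) (suc u) {suc i} i≢u = minus-other Z u (λ i≡u → i≢u (cong suc i≡u))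

subset-ext-at : ∀ {n} {A B : Subset n} (u : Fin n) → lookup A u ≡ lookup B u →
  (∀ {i} → i ≢ u → lookup A i ≡ lookup B i) → A ≡ B
subset-ext-at {A = A} {B} u at-u off-u = subset-ext pointwise
  where
  pointwise : ∀ i → lookup A i ≡ lookup B i
  pointwise i with i ≟ u
  ... | yes refl = at-u
  ... | no i≢u = off-u i≢u

module _ {n} (Z : Subset n) (u : Fin n) where

  minus-∉ : lookup Z u ≡ false → Z - u ≡ Z
  minus-∉ u∉Z = subset-ext-at u (trans (lookup-minus-self Z u) (sym u∉Z)) (lookup-minus-other Z u)

  ∪⁅⁆-∈ : lookup Z u ≡ true → Z ∪ ⁅ u ⁆ ≡ Z
  ∪⁅⁆-∈ u∈Z = subset-ext-at u (trans (lookup-∪⁅⁆-self Z u) (sym u∈Z)) (lookup-∪⁅⁆-other Z u)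

  minus-∈ : lookup Z u ≡ true → Z - u ≡ Z ⊕ ⁅ u ⁆
  minus-∈ u∈Z = subset-ext-at u
    (trans (lookup-minus-self Z u) (sym (trans (lookup-⊕⁅⁆-self Z u) (cong not u∈Z))))
    (λ i≢u → trans (lookup-minus-other Z u i≢u) (sym (lookup-⊕⁅⁆-other Z u i≢u)))

  ∪⁅⁆-∉ : lookup Z u ≡ false → Z ∪ ⁅ u ⁆ ≡ Z ⊕ ⁅ u ⁆
  ∪⁅⁆-∉ u∉Z = subset-ext-at u
    (trans (lookup-∪⁅⁆-self Z u) (sym (trans (lookup-⊕⁅⁆-self Z u) (cong not u∉Z))))
    (λ i≢u → trans (lookup-∪⁅⁆-other Z u i≢u) (sym (lookup-⊕⁅⁆-other Z u i≢u)))

module _ {n} (Z : Subset n) (u : Fin n) (S : Subset n) where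

  private
    ⊕-off : ∀ A B → (∀ {i} → i ≢ u → lookup A i ≡ lookup Z i) →
      (∀ {i} → i ≢ u → lookup B i ≡ lookup (Z ⊕ S) i) → ∀ {i} → i ≢ u → lookup (A ⊕ S) i ≡ lookup B i
    ⊕-off A B A≈Z B≈Z⊕S {i} i≢u =
      trans (lookup-⊕ A S i) (trans (cong (_xor lookup S i) (A≈Z i≢u)) (sym (trans (B≈Z⊕S i≢u) (lookup-⊕ Z S i))))

  minus-⊕-comm : lookup S u ≡ false → (Z - u) ⊕ S ≡ (Z ⊕ S) - u
  minus-⊕-comm u∉S = subset-ext-at u at-u
    (⊕-off (Z - u) ((Z ⊕ S) - u) (lookup-minus-other Z u) (lookup-minus-other (Z ⊕ S) u))
    where
    at-u : lookup ((Z - u) ⊕ S) u ≡ lookup ((Z ⊕ S) - u) u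
    at-u rewrite lookup-⊕ (Z - u) S u | lookup-minus-self Z u | lookup-minus-self (Z ⊕ S) u | u∉S = refl

  ∪⁅⁆-⊕-comm : lookup S u ≡ false → (Z ∪ ⁅ u ⁆) ⊕ S ≡ (Z ⊕ S) ∪ ⁅ u ⁆
  ∪⁅⁆-⊕-comm u∉S = subset-ext-at u at-u
    (⊕-off (Z ∪ ⁅ u ⁆) ((Z ⊕ S) ∪ ⁅ u ⁆) (lookup-∪⁅⁆-other Z u) (lookup-∪⁅⁆-other (Z ⊕ S) u))
    where
    at-u : lookup ((Z ∪ ⁅ u ⁆) ⊕ S) u ≡ lookup ((Z ⊕ S) ∪ ⁅ u ⁆) u
    at-u rewrite lookup-⊕ (Z ∪ ⁅ u ⁆) S u | lookup-∪⁅⁆-self Z u | lookup-∪⁅⁆-self (Z ⊕ S) u | u∉S =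
      refl

module _ {n} (Z : Subset n) {u w : Fin n} where

  ∪⁅⁆-minus-comm : w ≢ u → (Z ∪ ⁅ u ⁆) - w ≡ (Z - w) ∪ ⁅ u ⁆
  ∪⁅⁆-minus-comm w≢u = subset-ext λ i → pointwise i (i ≟ u) (i ≟ w)
    where
    pointwise : ∀ i → Dec (i ≡ u) → Dec (i ≡ w) → lookup ((Z ∪ ⁅ u ⁆) - w) i ≡ lookup ((Z - w) ∪ ⁅ u ⁆) i
    pointwise i (yes refl) (yes refl) = ⊥-elim (w≢u refl)
    pointwise i (yes refl) (no i≢w) rewrite lookup-minus-other (Z ∪ ⁅ i ⁆) w i≢w
      | lookup-∪⁅⁆-self Z i | lookup-∪⁅⁆-self (Z - w) i = refl
    pointwise i (no i≢u) (yes refl) rewrite lookup-minus-self (Z ∪ ⁅ u ⁆) i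
      | lookup-∪⁅⁆-other (Z - i) u i≢u | lookup-minus-self Z i = refl
    pointwise i (no i≢u) (no i≢w) rewrite lookup-minus-other (Z ∪ ⁅ u ⁆) w i≢w | lookup-∪⁅⁆-other (Z - w) u i≢u
      | lookup-∪⁅⁆-other Z u i≢u | lookup-minus-other Z w i≢w = refl

⊕-assoc : ∀ {n} (A B C : Subset n) → (A ⊕ B) ⊕ C ≡ A ⊕ (B ⊕ C)
⊕-assoc [] [] [] = refl
⊕-assoc (a ∷ A) (b ∷ B) (c ∷ C) = cong₂ _∷_ (xor-assoc a b c) (⊕-assoc A B C)

⊕-comm : ∀ {n} (A B : Subset n) → A ⊕ B ≡ B ⊕ A
⊕-comm [] [] = refl
⊕-comm (a ∷ A) (b ∷ B) = cong₂ _∷_ (xor-comm a b) (⊕-comm A B)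

⊕-identityʳ : ∀ {n} (A : Subset n) → A ⊕ ⊥ ≡ A
⊕-identityʳ [] = refl
⊕-identityʳ (a ∷ A) = cong₂ _∷_ (xor-identityʳ a) (⊕-identityʳ A)

⊕-cancelʳ : ∀ {n} (A B : Subset n) → (A ⊕ B) ⊕ B ≡ A
⊕-cancelʳ [] [] = refl
⊕-cancelʳ (a ∷ A) (b ∷ B) = cong₂ _∷_ cancel (⊕-cancelʳ A B)
  where
  cancel : (a xor b) xor b ≡ a
  cancel = trans (xor-assoc a b b) (trans (cong (a xor_) (xor-same b)) (xor-identityʳ a))

⊕-swap : ∀ {n} (A B C : Subset n) → (A ⊕ B) ⊕ C ≡ (A ⊕ C) ⊕ B
⊕-swap A B C = trans (⊕-assoc A B C) (trans (cong (A ⊕_) (⊕-comm B C)) (sym (⊕-assoc A C B)))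

⊕-cancel-middle : ∀ {n} (A B C : Subset n) → (A ⊕ C) ⊕ (B ⊕ C) ≡ A ⊕ B
⊕-cancel-middle A B C = trans (⊕-swap A C (B ⊕ C)) (trans (⊕-assoc A (B ⊕ C) C) (cong (A ⊕_) (⊕-cancelʳ B C)))

⊕-pair : ∀ {n} (Z : Subset n) {u v} → v ≢ u → Z ⊕ (⁅ u ⁆ ∪ ⁅ v ⁆) ≡ (Z ⊕ ⁅ u ⁆) ⊕ ⁅ v ⁆
⊕-pair Z {u} {v} v≢u =
  trans (cong (Z ⊕_) (∪⁅⁆-∉ ⁅ u ⁆ v (lookup-⁅⁆-other u v≢u))) (sym (⊕-assoc Z ⁅ u ⁆ ⁅ v ⁆))

minus-⊕⁅⁆ : ∀ {n} (Z : Subset n) u → (Z - u) ⊕ ⁅ u ⁆ ≡ Z ∪ ⁅ u ⁆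
minus-⊕⁅⁆ Z u with lookup Z u in u∈Z
... | true =
  trans (cong (_⊕ ⁅ u ⁆) (minus-∈ Z u u∈Z)) (trans (⊕-cancelʳ Z ⁅ u ⁆) (sym (∪⁅⁆-∈ Z u u∈Z)))
... | false = trans (cong (_⊕ ⁅ u ⁆) (minus-∉ Z u u∈Z)) (sym (∪⁅⁆-∉ Z u u∈Z))

∈-⊕⁅⁆-∉ : ∀ {n} (Z : Subset n) u → lookup Z u ≡ false → lookup (Z ⊕ ⁅ u ⁆) u ≡ true
∈-⊕⁅⁆-∉ Z u u∉Z = trans (lookup-⊕⁅⁆-self Z u) (cong not u∉Z)

∉-⊕⁅⁆-∈ : ∀ {n} (Z : Subset n) u → lookup Z u ≡ true → lookup (Z ⊕ ⁅ u ⁆) u ≡ false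
∉-⊕⁅⁆-∈ Z u u∈Z = trans (lookup-⊕⁅⁆-self Z u) (cong not u∈Z)

lookup-⊕-∉ : ∀ {n} (Z S : Subset n) u → lookup S u ≡ false → lookup (Z ⊕ S) u ≡ lookup Z u
lookup-⊕-∉ Z S u u∉S = trans (lookup-⊕ Z S u) (trans (cong (lookup Z u xor_) u∉S) (xor-identityʳ _))

case-on-membership : ∀ {n} (Z : Subset n) u {A : Set} → (lookup Z u ≡ true → A) → (lookup Z u ≡ false → A) → A
case-on-membership Z u {A} contains omits = go (lookup Z u) refl
  where
  go : ∀ b → lookup Z u ≡ b → A
  go true = contains
  go false = omits

card-⊕⁅⁆-∈ : ∀ {n} (Z : Subset n) u → lookup Z u ≡ true → suc ∣ Z ⊕ ⁅ u ⁆ ∣ ≡ ∣ Z ∣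
card-⊕⁅⁆-∈ (true ∷ Z) zero _ = cong (λ W → suc ∣ W ∣) (⊕-identityʳ Z)
card-⊕⁅⁆-∈ (true ∷ Z) (suc u) u∈Z = cong suc (card-⊕⁅⁆-∈ Z u u∈Z)
card-⊕⁅⁆-∈ (false ∷ Z) (suc u) u∈Z = card-⊕⁅⁆-∈ Z u u∈Z

card-⊕⁅⁆-∉ : ∀ {n} (Z : Subset n) u → lookup Z u ≡ false → ∣ Z ⊕ ⁅ u ⁆ ∣ ≡ suc ∣ Z ∣
card-⊕⁅⁆-∉ (false ∷ Z) zero _ = cong (λ W → suc ∣ W ∣) (⊕-identityʳ Z)
card-⊕⁅⁆-∉ (true ∷ Z) (suc u) u∉Z = cong suc (card-⊕⁅⁆-∉ Z u u∉Z)
card-⊕⁅⁆-∉ (false ∷ Z) (suc u) u∉Z = card-⊕⁅⁆-∉ Z u u∉Z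

card-0 : ∀ {n} (v : Subset n) → ∣ v ∣ ≡ 0 → ∀ w → lookup v w ≡ false
card-0 (false ∷ v) _ zero = refl
card-0 (false ∷ v) ∣v∣≡0 (suc w) = card-0 v ∣v∣≡0 w

card-suc : ∀ {n} (v : Subset n) {k} → ∣ v ∣ ≡ suc k → ∃ λ u → lookup v u ≡ true
card-suc (true ∷ v) _ = zero , refl
card-suc (false ∷ v) ∣v∣≡1+k with card-suc v ∣v∣≡1+k
... | u , u∈v = suc u , u∈v

-- Sums over all subsets

Σˢ : ∀ {n} → (Subset n → ℕ) → ℕ
Σˢ {zero} f = f []
Σˢ {suc n} f = Σˢ (λ s → f (outside ∷ s) + f (inside ∷ s))

Σˢ-cong : ∀ {n} {f g : Subset n → ℕ} → (∀ X → f X ≡ g X) → Σˢ f ≡ Σˢ g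
Σˢ-cong {zero} f≗g = f≗g []
Σˢ-cong {suc n} f≗g = Σˢ-cong (λ s → cong₂ _+_ (f≗g (outside ∷ s)) (f≗g (inside ∷ s)))

Σˢ-+ : ∀ {n} (f g : Subset n → ℕ) → Σˢ (λ X → f X + g X) ≡ Σˢ f + Σˢ g
Σˢ-+ {zero} f g = refl
Σˢ-+ {suc n} f g =
  trans (Σˢ-cong (λ s → interchange (f (outside ∷ s)) (g (outside ∷ s)) (f (inside ∷ s)) (g (inside ∷ s))))
        (Σˢ-+ (λ s → f (outside ∷ s) + f (inside ∷ s)) (λ s → g (outside ∷ s) + g (inside ∷ s)))
  where
  interchange : ∀ a b c d → (a + b) + (c + d) ≡ (a + c) + (b + d)
  interchange = solve-∀

Σˢ-* : ∀ {n} (k : ℕ) (f : Subset n → ℕ) → Σˢ (λ X → k * f X) ≡ k * Σˢ f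
Σˢ-* {zero} k f = refl
Σˢ-* {suc n} k f = trans (Σˢ-cong (λ s → sym (*-distribˡ-+ k (f (outside ∷ s)) (f (inside ∷ s)))))
                          (Σˢ-* k (λ s → f (outside ∷ s) + f (inside ∷ s)))

Σˢ-zero : ∀ {n} (f : Subset n → ℕ) → (∀ X → f X ≡ 0) → Σˢ f ≡ 0
Σˢ-zero {zero} f f≗0 = f≗0 []
Σˢ-zero {suc n} f f≗0 =
  Σˢ-zero (λ s → f (outside ∷ s) + f (inside ∷ s)) (λ s → cong₂ _+_ (f≗0 (outside ∷ s)) (f≗0 (inside ∷ s)))

Σˢ-translate : ∀ {n} (f : Subset n → ℕ) S → Σˢ (λ X → f (X ⊕ S)) ≡ Σˢ f
Σˢ-translate {zero} f [] = refl
Σˢ-translate {suc n} f (outside ∷ S) = Σˢ-translate (λ s → f (outside ∷ s) + f (inside ∷ s)) S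
Σˢ-translate {suc n} f (inside ∷ S) =
  trans (Σˢ-cong (λ s → +-comm (f (inside ∷ (s ⊕ S))) (f (outside ∷ (s ⊕ S)))))
        (Σˢ-translate (λ s → f (outside ∷ s) + f (inside ∷ s)) S)

unless : Bool → ℕ → ℕ
unless b k = if b then 0 else k

-- Translating by ⁅ u ⁆ pairs each X ∌ u with X ∪ ⁅ u ⁆.
Σˢ-pairs : ∀ {n} (u : Fin n) (f : Subset n → ℕ) →
  Σˢ f ≡ Σˢ (λ X → unless (lookup X u) (f X + f (X ⊕ ⁅ u ⁆)))
Σˢ-pairs {n} u f = begin
  Σˢ f                                                   ≡⟨ Σˢ-cong split ⟩
  Σˢ (λ X → omitting X + containing X)                   ≡⟨ Σˢ-+ omitting containing ⟩
  Σˢ omitting + Σˢ containing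
    ≡⟨ cong (Σˢ omitting +_) (sym (Σˢ-translate containing ⁅ u ⁆)) ⟩
  Σˢ omitting + Σˢ (λ X → containing (X ⊕ ⁅ u ⁆))
    ≡⟨ sym (Σˢ-+ omitting (λ X → containing (X ⊕ ⁅ u ⁆))) ⟩
  Σˢ (λ X → omitting X + containing (X ⊕ ⁅ u ⁆))         ≡⟨ Σˢ-cong merge ⟩
  Σˢ (λ X → unless (lookup X u) (f X + f (X ⊕ ⁅ u ⁆)))  ∎
  where
  open ≡-Reasoning
  omitting containing : Subset n → ℕ
  omitting X = unless (lookup X u) (f X)
  containing X = if lookup X u then f X else 0
  split : ∀ X → f X ≡ omitting X + containing X
  split X with lookup X u
  ... | true = refl
  ... | false = sym (+-identityʳ (f X))
  merge : ∀ X → omitting X + containing (X ⊕ ⁅ u ⁆) ≡ unless (lookup X u) (f X + f (X ⊕ ⁅ u ⁆))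
  merge X rewrite lookup-⊕⁅⁆-self X u with lookup X u
  ... | true = refl
  ... | false = refl

unless-cong : ∀ b {m k} → (b ≡ false → m ≡ k) → unless b m ≡ unless b k
unless-cong true _ = refl
unless-cong false m≡k = m≡k refl

unless-+ : ∀ b m k → unless b (m + k) ≡ unless b m + unless b k
unless-+ true m k = refl
unless-+ false m k = refl

unless-* : ∀ b k m → unless b (k * m) ≡ k * unless b m
unless-* true k m = sym (*-zeroʳ k)
unless-* false k m = refl

Σˢ-⊥ : ∀ {n} (f : Subset n → ℕ) → (∀ X → X ⊆ᵇ ⊥ ≡ false → f X ≡ 0) → Σˢ f ≡ f ⊥
Σˢ-⊥ {zero} f _ = refl
Σˢ-⊥ {suc n} f vanishes =
  trans (Σˢ-cong (λ s → trans (cong (f (outside ∷ s) +_) (vanishes (inside ∷ s) refl)) (+-identityʳ _)))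
        (Σˢ-⊥ (λ s → f (outside ∷ s)) (λ s → vanishes (outside ∷ s)))

Σ²∌ : ∀ {n} → Fin n → (Subset n → Subset n → ℕ) → ℕ
Σ²∌ u f = Σˢ λ X → unless (lookup X u) (Σˢ λ Y → unless (lookup Y u) (f X Y))

module _ {n} (u : Fin n) where

  Σ²∌-cong : ∀ {f g : Subset n → Subset n → ℕ} →
    (∀ X Y → lookup X u ≡ false → lookup Y u ≡ false → f X Y ≡ g X Y) → Σ²∌ u f ≡ Σ²∌ u g
  Σ²∌-cong f≗g = Σˢ-cong λ X → unless-cong (lookup X u) λ u∉X →
                 Σˢ-cong λ Y → unless-cong (lookup Y u) λ u∉Y → f≗g X Y u∉X u∉Y

  private
    inner : (Subset n → Subset n → ℕ) → Subset n → ℕ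
    inner f X = Σˢ λ Y → unless (lookup Y u) (f X Y)

    outer : (Subset n → ℕ) → Subset n → ℕ
    outer h X = unless (lookup X u) (h X)

  Σ²∌-+ : ∀ (f g : Subset n → Subset n → ℕ) → Σ²∌ u (λ X Y → f X Y + g X Y) ≡ Σ²∌ u f + Σ²∌ u g
  Σ²∌-+ f g = trans (Σˢ-cong row) (Σˢ-+ (outer (inner f)) (outer (inner g)))
    where
    row : ∀ X → outer (inner (λ X Y → f X Y + g X Y)) X ≡ outer (inner f) X + outer (inner g) X
    row X = trans (cong (unless (lookup X u))
                    (trans (Σˢ-cong λ Y → unless-+ (lookup Y u) (f X Y) (g X Y))
                           (Σˢ-+ (λ Y → unless (lookup Y u) (f X Y)) (λ Y → unless (lookup Y u) (g X Y)))))
                  (unless-+ (lookup X u) (inner f X) (inner g X))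

  Σ²∌-* : ∀ k (f : Subset n → Subset n → ℕ) → Σ²∌ u (λ X Y → k * f X Y) ≡ k * Σ²∌ u f
  Σ²∌-* k f = trans (Σˢ-cong row) (Σˢ-* k (outer (inner f)))
    where
    row : ∀ X → outer (inner (λ X Y → k * f X Y)) X ≡ k * outer (inner f) X
    row X = trans (cong (unless (lookup X u))
                    (trans (Σˢ-cong λ Y → unless-* (lookup Y u) k (f X Y))
                           (Σˢ-* k (λ Y → unless (lookup Y u) (f X Y)))))
                  (unless-* (lookup X u) k (inner f X))

-- Families of subsets and their distance

Family : ℕ → Set
Family n = Subset n → Bool

infix 4 _≈_
_≈_ : ∀ {n} → Family n → Family n → Set
d ≈ e = ∀ Z → d Z ≡ e Z

≈-sym : ∀ {n} {d e : Family n} → d ≈ e → e ≈ d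
≈-sym d≈e Z = sym (d≈e Z)

≈-trans : ∀ {n} {d e f : Family n} → d ≈ e → e ≈ f → d ≈ f
≈-trans d≈e e≈f Z = trans (d≈e Z) (e≈f Z)

NonEmpty : ∀ {n} → Family n → Set
NonEmpty d = ∃ λ Z → d Z ≡ true

NonEmpty-cong : ∀ {n} {d e : Family n} → d ≈ e → NonEmpty d → NonEmpty e
NonEmpty-cong d≈e (Z , dZ) = Z , trans (sym (d≈e Z)) dZ

-- Definitionally equal to dist (v , d) for every v.
distᶠ : ∀ {n} → Family n → ℕ
distᶠ {n} d = foldr (λ Z m → if d Z then ∣ Z ∣ ⊓ m else m) n (allSubsets n)

∈-allSubsets : ∀ {n} (Z : Subset n) → Z ∈ˡ allSubsets n
∈-allSubsets [] = here refl
∈-allSubsets (z ∷ Z) = extend z (∈-allSubsets Z)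
  where
  extend : ∀ {m} {Z : Subset m} {L} z → Z ∈ˡ L →
    (z ∷ Z) ∈ˡ concatMap (λ s → (outside ∷ s) ∷ (inside ∷ s) ∷ []) L
  extend {L = s ∷ _} outside (here refl) = here refl
  extend {L = s ∷ _} inside (here refl) = there (here refl)
  extend {L = s ∷ _} z (there Z∈L) = there (there (extend z Z∈L))

module _ {n : ℕ} (d : Family n) where

  private
    distOver : List (Subset n) → ℕ
    distOver = foldr (λ Z m → if d Z then ∣ Z ∣ ⊓ m else m) n

    distOver-≤ : ∀ {Z} L → Z ∈ˡ L → d Z ≡ true → distOver L ≤ ∣ Z ∣
    distOver-≤ (_ ∷ L) (here refl) dZ rewrite dZ = m⊓n≤m _ _
    distOver-≤ (W ∷ L) (there Z∈L) dZ with d W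
    ... | true = ≤-trans (m⊓n≤n _ _) (distOver-≤ L Z∈L dZ)
    ... | false = distOver-≤ L Z∈L dZ

    distOver-≤-default : ∀ L → distOver L ≤ n
    distOver-≤-default [] = ≤-refl
    distOver-≤-default (W ∷ L) with d W
    ... | true = ≤-trans (m⊓n≤n _ _) (distOver-≤-default L)
    ... | false = distOver-≤-default L

    distOver-attained : ∀ L → distOver L ≡ n ⊎ ∃ λ Z → d Z ≡ true × distOver L ≡ ∣ Z ∣
    distOver-attained [] = inj₁ refl
    distOver-attained (W ∷ L) with d W in dW
    ... | false = distOver-attained L
    ... | true with ⊓-sel ∣ W ∣ (distOver L)
    ...   | inj₁ eq = inj₂ (W , dW , eq)
    ...   | inj₂ eq rewrite eq = distOver-attained L

  distᶠ-≤ : ∀ Z → d Z ≡ true → distᶠ d ≤ ∣ Z ∣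
  distᶠ-≤ Z = distOver-≤ (allSubsets n) (∈-allSubsets Z)

  distᶠ-≤-default : distᶠ d ≤ n
  distᶠ-≤-default = distOver-≤-default (allSubsets n)

  distᶠ-attained-or-default : distᶠ d ≡ n ⊎ ∃ λ Z → d Z ≡ true × distᶠ d ≡ ∣ Z ∣
  distᶠ-attained-or-default = distOver-attained (allSubsets n)

distᶠ-attained : ∀ {n} (d : Family n) → NonEmpty d → ∃ λ Z → d Z ≡ true × distᶠ d ≡ ∣ Z ∣
distᶠ-attained d (Z₀ , dZ₀) with distᶠ-attained-or-default d
... | inj₂ attained = attained
... | inj₁ eq = Z₀ , dZ₀ , ≤-antisym (distᶠ-≤ d Z₀ dZ₀) (≤-trans (∣p∣≤n Z₀) (≤-reflexive (sym eq)))

distᶠ-mono : ∀ {n} (d e : Family n) →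
  (∀ W → e W ≡ true → ∃ λ W′ → d W′ ≡ true × ∣ W′ ∣ ≤ ∣ W ∣) → distᶠ d ≤ distᶠ e
distᶠ-mono d e dominated with distᶠ-attained-or-default e
... | inj₁ eq = ≤-trans (distᶠ-≤-default d) (≤-reflexive (sym eq))
... | inj₂ (Z , eZ , eq) with dominated Z eZ
...   | W , dW , W≤Z = ≤-trans (distᶠ-≤ d W dW) (≤-trans W≤Z (≤-reflexive (sym eq)))

distᶠ-cong : ∀ {n} {d e : Family n} → d ≈ e → distᶠ d ≡ distᶠ e
distᶠ-cong {d = d} {e} d≈e = ≤-antisym (distᶠ-mono d e (λ W eW → W , trans (d≈e W) eW , ≤-refl))
                                       (distᶠ-mono e d (λ W dW → W , trans (sym (d≈e W)) dW , ≤-refl))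

-- Pivots, loop complementations, dual pivots and deletions

dualPivotᶠ : ∀ {n} → Family n → Fin n → Family n
dualPivotᶠ d w = loopD (pivotD (loopD d w) ⁅ w ⁆) w

module _ {n} {d e : Family n} (d≈e : d ≈ e) where

  pivot-cong : ∀ S → pivotD d S ≈ pivotD e S
  pivot-cong S Z = d≈e (Z ⊕ S)

  loop-cong : ∀ w → loopD d w ≈ loopD e w
  loop-cong w Z = cong₂ (λ a b → a xor (lookup Z w ∧ b)) (d≈e Z) (d≈e (Z - w))

  delete-cong : ∀ u → delD d u ≈ delD e u
  delete-cong u Z = cong (_∧ not (lookup Z u)) (d≈e Z)

dualPivot-cong : ∀ {n} {d e : Family n} w → d ≈ e → dualPivotᶠ d w ≈ dualPivotᶠ e w
dualPivot-cong w d≈e = loop-cong (pivot-cong (loop-cong d≈e w) ⁅ w ⁆) w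

module _ {n} (d : Family n) where

  pivot-pivot : ∀ S T → pivotD (pivotD d S) T ≈ pivotD (pivotD d T) S
  pivot-pivot S T Z = cong d (⊕-swap Z T S)

  loop-pivot : ∀ S w → lookup S w ≡ false → loopD (pivotD d S) w ≈ pivotD (loopD d w) S
  loop-pivot S w w∉S Z rewrite lookup-⊕ Z S w | w∉S | xor-identityʳ (lookup Z w) | minus-⊕-comm Z w S w∉S = refl

  loop-loop : ∀ w u → w ≢ u → loopD (loopD d w) u ≈ loopD (loopD d u) w
  loop-loop w u w≢u Z rewrite lookup-minus-other Z u w≢u | lookup-minus-other Z w (≢-sym w≢u)
                            | p─x─y≡p─y─x Z u w =
    solve 6 (λ a b c e f g → (a :+ (b :* c)) :+ (e :* (f :+ (b :* g))) := (a :+ (e :* f)) :+ (b :* (c :+ (e :* g))))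
      refl (d Z) (lookup Z w) (d (Z - w)) (lookup Z u) (d (Z - u)) (d ((Z - w) - u))

  delete-pivot : ∀ S u → lookup S u ≡ false → delD (pivotD d S) u ≈ pivotD (delD d u) S
  delete-pivot S u u∉S Z rewrite lookup-⊕ Z S u | u∉S | xor-identityʳ (lookup Z u) = refl

  delete-loop : ∀ w u → w ≢ u → delD (loopD d w) u ≈ loopD (delD d u) w
  delete-loop w u w≢u Z rewrite lookup-minus-other Z w (≢-sym w≢u) =
    solve 4 (λ a b c e → (a :+ (b :* c)) :* e := (a :* e) :+ (b :* (c :* e)))
      refl (d Z) (lookup Z w) (d (Z - w)) (not (lookup Z u))

Commutes : ∀ {n} → (Family n → Family n) → (Family n → Family n) → Set
Commutes {n} f g = ∀ (d : Family n) → f (g d) ≈ g (f d)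

commutes-dualPivot : ∀ {n} (f : Family n → Family n) w →
  Commutes f (λ d → loopD d w) → Commutes f (λ d → pivotD d ⁅ w ⁆) → Commutes f (λ d → dualPivotᶠ d w)
commutes-dualPivot f w f-loop f-pivot d =
  ≈-trans (f-loop _) (loop-cong (≈-trans (f-pivot _) (pivot-cong (f-loop d) ⁅ w ⁆)) w)

pivot-dualPivot : ∀ {n} S (w : Fin n) → lookup S w ≡ false → Commutes (λ d → pivotD d S) (λ d → dualPivotᶠ d w)
pivot-dualPivot S w w∉S =
  commutes-dualPivot (λ d → pivotD d S) w (λ d → ≈-sym (loop-pivot d S w w∉S)) (λ d → pivot-pivot d ⁅ w ⁆ S)

loop-dualPivot : ∀ {n} (u w : Fin n) → w ≢ u → Commutes (λ d → loopD d u) (λ d → dualPivotᶠ d w)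
loop-dualPivot u w w≢u =
  commutes-dualPivot (λ d → loopD d u) w (λ d → loop-loop d w u w≢u)
    (λ d → loop-pivot d ⁅ w ⁆ u (lookup-⁅⁆-other w (≢-sym w≢u)))

delete-dualPivot : ∀ {n} (u w : Fin n) → w ≢ u → Commutes (λ d → delD d u) (λ d → dualPivotᶠ d w)
delete-dualPivot u w w≢u =
  commutes-dualPivot (λ d → delD d u) w (λ d → delete-loop d w u w≢u)
    (λ d → delete-pivot d ⁅ w ⁆ u (lookup-⁅⁆-other w (≢-sym w≢u)))

dualPivot-dualPivot : ∀ {n} (u w : Fin n) → w ≢ u → Commutes (λ d → dualPivotᶠ d u) (λ d → dualPivotᶠ d w)
dualPivot-dualPivot u w w≢u d = ≈-sym
  (commutes-dualPivot (λ e → dualPivotᶠ e w) u (λ e → ≈-sym (loop-dualPivot u w w≢u e))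
    (λ e → ≈-sym (pivot-dualPivot ⁅ u ⁆ w (lookup-⁅⁆-other u w≢u) e)) d)

dualPivotsᶠ : ∀ {n} → Family n → Subset n → List (Fin n) → Family n
dualPivotsᶠ d X = foldr (λ w e → if lookup X w then dualPivotᶠ e w else e) d

dualPivots-cong : ∀ {n} {d e : Family n} X L → d ≈ e → dualPivotsᶠ d X L ≈ dualPivotsᶠ e X L
dualPivots-cong X [] d≈e = d≈e
dualPivots-cong X (w ∷ L) d≈e with lookup X w
... | true = dualPivot-cong w (dualPivots-cong X L d≈e)
... | false = dualPivots-cong X L d≈e

commutes-dualPivots : ∀ {n} (f : Family n → Family n) → (∀ {d e} → d ≈ e → f d ≈ f e) → ∀ X L →
  (∀ w → lookup X w ≡ true → Commutes f (λ d → dualPivotᶠ d w)) →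
  ∀ d → f (dualPivotsᶠ d X L) ≈ dualPivotsᶠ (f d) X L
commutes-dualPivots f f-cong X [] f-dual d Z = refl
commutes-dualPivots f f-cong X (w ∷ L) f-dual d with lookup X w in w∈X
... | true = ≈-trans (f-dual w w∈X _) (dualPivot-cong w (commutes-dualPivots f f-cong X L f-dual d))
... | false = commutes-dualPivots f f-cong X L f-dual d

dualPivots-other : ∀ {n} (d : Family n) X u {L} → All (u ≢_) L →
  dualPivotsᶠ d (X ⊕ ⁅ u ⁆) L ≡ dualPivotsᶠ d X L
dualPivots-other d X u [] = refl
dualPivots-other d X u {w ∷ _} (u≢w ∷ u∉L)
  rewrite lookup-⊕⁅⁆-other X u (≢-sym u≢w) | dualPivots-other d X u u∉L = refl

dualPivots-⊕⁅⁆ : ∀ {n} (d : Family n) X u {L} → Unique L → u ∈ˡ L → lookup X u ≡ false →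
  dualPivotsᶠ d (X ⊕ ⁅ u ⁆) L ≈ dualPivotᶠ (dualPivotsᶠ d X L) u
dualPivots-⊕⁅⁆ d X u (u∉L ∷ _) (here refl) u∉X
  rewrite lookup-⊕⁅⁆-self X u | u∉X | dualPivots-other d X u u∉L = λ Z → refl
dualPivots-⊕⁅⁆ d X u {w ∷ L} (w∉L ∷ unique) (there u∈L) u∉X
  rewrite lookup-⊕⁅⁆-other X u (All.lookup w∉L u∈L) with lookup X w
... | true = ≈-trans (dualPivot-cong w (dualPivots-⊕⁅⁆ d X u unique u∈L u∉X))
                     (≈-sym (dualPivot-dualPivot u w (All.lookup w∉L u∈L) (dualPivotsᶠ d X L)))
... | false = dualPivots-⊕⁅⁆ d X u unique u∈L u∉X

-- The family of M * Y *̄ X, whose distance is the exponent of the (X , Y) term of Q₁ (M).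
twist : ∀ {n} → Family n → Subset n → Subset n → Family n
twist {n} d X Y = dualPivotsᶠ (pivotD d Y) X (allFin n)

twist-raw : ∀ {n} (v : Subset n) d X Y → proj₂ ((v , d) *ᵖ Y *̄ˢ X) ≡ twist d X Y
twist-raw {n} v d X Y = go (allFin n)
  where
  go : ∀ L → proj₂ (foldr (λ w N → if w ∈ᵇ X then N *̄ w else N) ((v , d) *ᵖ Y) L)
             ≡ dualPivotsᶠ (pivotD d Y) X L
  go [] = refl
  go (w ∷ L) with lookup X w
  ... | true = cong (λ e → dualPivotᶠ e w) (go L)
  ... | false = go L

≢-of-∉ : ∀ {n} {X : Subset n} {u w} → lookup X u ≡ false → lookup X w ≡ true → w ≢ u
≢-of-∉ u∉X w∈X refl with trans (sym u∉X) w∈X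
... | ()

module _ {n} (g : Family n) (X : Subset n) (u : Fin n) (u∉X : lookup X u ≡ false) where

  private
    commutes-twist : ∀ (f : Family n → Family n) → (∀ {d e} → d ≈ e → f d ≈ f e) →
      (∀ w → w ≢ u → Commutes f (λ d → dualPivotᶠ d w)) →
      ∀ d → f (dualPivotsᶠ d X (allFin n)) ≈ dualPivotsᶠ (f d) X (allFin n)
    commutes-twist f f-cong f-dual =
      commutes-dualPivots f f-cong X (allFin n) (λ w w∈X → f-dual w (≢-of-∉ {X = X} u∉X w∈X))

  twist-pivot : ∀ Y → twist (pivotD g ⁅ u ⁆) X Y ≈ pivotD (twist g X Y) ⁅ u ⁆
  twist-pivot Y = ≈-trans (dualPivots-cong X (allFin n) (pivot-pivot g ⁅ u ⁆ Y))
    (≈-sym (commutes-twist (λ d → pivotD d ⁅ u ⁆) (λ d≈e → pivot-cong d≈e ⁅ u ⁆)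
      (λ w w≢u → pivot-dualPivot ⁅ u ⁆ w (lookup-⁅⁆-other u w≢u)) (pivotD g Y)))

  twist-⊕⁅⁆-right : ∀ Y → twist g X (Y ⊕ ⁅ u ⁆) ≈ pivotD (twist g X Y) ⁅ u ⁆
  twist-⊕⁅⁆-right Y = ≈-trans (dualPivots-cong X (allFin n) (λ Z → cong g (sym (⊕-assoc Z Y ⁅ u ⁆))))
                                (twist-pivot Y)

  twist-⊕⁅⁆-left : ∀ Y → twist g (X ⊕ ⁅ u ⁆) Y ≈ dualPivotᶠ (twist g X Y) u
  twist-⊕⁅⁆-left Y = dualPivots-⊕⁅⁆ (pivotD g Y) X u (allFin⁺ n) (∈-allFin u) u∉X

  module _ (Y : Subset n) (u∉Y : lookup Y u ≡ false) where

    twist-delete : twist (delD g u) X Y ≈ delD (twist g X Y) u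
    twist-delete = ≈-trans (dualPivots-cong X (allFin n) (≈-sym (delete-pivot g Y u u∉Y)))
      (≈-sym (commutes-twist (λ d → delD d u) (λ d≈e → delete-cong d≈e u)
        (λ w w≢u → delete-dualPivot u w w≢u) (pivotD g Y)))

    twist-dualPivot : twist (dualPivotᶠ g u) X Y ≈ dualPivotᶠ (twist g X Y) u
    twist-dualPivot = ≈-trans (dualPivots-cong X (allFin n) (pivot-dualPivot Y u u∉Y g))
      (≈-sym (commutes-twist (λ d → dualPivotᶠ d u) (dualPivot-cong u)
        (λ w w≢u → dualPivot-dualPivot u w w≢u) (pivotD g Y)))

-- Q₁ as a double sum

admissible : ∀ {n} → Subset n → Subset n → Subset n → Bool
admissible v X Y = (X ⊆ᵇ v) ∧ (Y ⊆ᵇ v) ∧ disjointᵇ X Y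

Q₁-term : ∀ {n} → Subset n → Family n → ℕ → Subset n → Subset n → ℕ
Q₁-term v d y X Y = if admissible v X Y then y ^ distᶠ (twist d X Y) else 0

sum-concatMap : ∀ {A : Set} (g : A → List ℕ) L → sum (concatMap g L) ≡ sum (map (λ a → sum (g a)) L)
sum-concatMap g [] = refl
sum-concatMap g (a ∷ L) = trans (sum-++ (g a) (concatMap g L)) (cong (sum (g a) +_) (sum-concatMap g L))

sum-allSubsets : ∀ {n} (f : Subset n → ℕ) → sum (map f (allSubsets n)) ≡ Σˢ f
sum-allSubsets {zero} f = +-identityʳ (f [])
sum-allSubsets {suc n} f = begin
  sum (map f (concatMap pair (allSubsets n)))    ≡⟨ cong sum (map-concatMap f pair (allSubsets n)) ⟩
  sum (concatMap (map f ∘ pair) (allSubsets n))  ≡⟨ sum-concatMap (map f ∘ pair) (allSubsets n) ⟩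
  sum (map (sum ∘ map f ∘ pair) (allSubsets n))  ≡⟨ sum-allSubsets (sum ∘ map f ∘ pair) ⟩
  Σˢ (sum ∘ map f ∘ pair)                         ≡⟨ Σˢ-cong (λ s → cong (f (outside ∷ s) +_) (+-identityʳ _)) ⟩
  Σˢ (λ s → f (outside ∷ s) + f (inside ∷ s))    ∎
  where
  open ≡-Reasoning
  pair : Subset n → List (Subset (suc n))
  pair s = (outside ∷ s) ∷ (inside ∷ s) ∷ []

Q₁-double-sum : ∀ {n} (v : Subset n) d y → Q₁ (v , d) y ≡ Σˢ λ X → Σˢ λ Y → Q₁-term v d y X Y
Q₁-double-sum {n} v d y = begin
  Q₁ (v , d) y                               ≡⟨ sum-concatMap row (allSubsets n) ⟩
  sum (map (sum ∘ row) (allSubsets n))       ≡⟨ sum-allSubsets (sum ∘ row) ⟩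
  Σˢ (sum ∘ row)                              ≡⟨ Σˢ-cong (λ X → sum-allSubsets (entry X)) ⟩
  Σˢ (λ X → Σˢ (entry X))                     ≡⟨ Σˢ-cong (λ X → Σˢ-cong (entry≡term X)) ⟩
  Σˢ (λ X → Σˢ (λ Y → Q₁-term v d y X Y))    ∎
  where
  open ≡-Reasoning
  entry : Subset n → Subset n → ℕ
  entry X Y = if admissible v X Y then y ^ dist ((v , d) *ᵖ Y *̄ˢ X) else 0
  entry≡term : ∀ X Y → entry X Y ≡ Q₁-term v d y X Y
  entry≡term X Y = cong (λ e → if admissible v X Y then y ^ distᶠ e else 0) (twist-raw v d X Y)
  row : Subset n → List ℕ
  row X = map (entry X) (allSubsets n)

⊆ᵇ-minus : ∀ {n} (X v : Subset n) u → lookup X u ≡ false → X ⊆ᵇ (v - u) ≡ X ⊆ᵇ v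
⊆ᵇ-minus (false ∷ X) (_ ∷ v) zero _ = cong (X ⊆ᵇ_) (p─⊥≡p v)
⊆ᵇ-minus (x ∷ X) (b ∷ v) (suc u) u∉X = cong ((not x ∨ b) ∧_) (⊆ᵇ-minus X v u u∉X)

⊆ᵇ-⊕⁅⁆ : ∀ {n} (X v : Subset n) u → lookup X u ≡ false → lookup v u ≡ true →
  (X ⊕ ⁅ u ⁆) ⊆ᵇ v ≡ X ⊆ᵇ v
⊆ᵇ-⊕⁅⁆ (false ∷ X) (true ∷ v) zero _ _ = cong (_⊆ᵇ v) (⊕-identityʳ X)
⊆ᵇ-⊕⁅⁆ (x ∷ X) (b ∷ v) (suc u) u∉X u∈v =
  cong₂ _∧_ (cong (λ a → not a ∨ b) (xor-identityʳ x)) (⊆ᵇ-⊕⁅⁆ X v u u∉X u∈v)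

⊆ᵇ-∉ : ∀ {n} (X v : Subset n) u → lookup X u ≡ true → lookup v u ≡ false → X ⊆ᵇ v ≡ false
⊆ᵇ-∉ (true ∷ X) (false ∷ v) zero _ _ = refl
⊆ᵇ-∉ (x ∷ X) (b ∷ v) (suc u) u∈X u∉v = trans (cong ((not x ∨ b) ∧_) (⊆ᵇ-∉ X v u u∈X u∉v)) (∧-zeroʳ _)

disjointᵇ-⊕⁅⁆ʳ : ∀ {n} (X Y : Subset n) u → lookup X u ≡ false → disjointᵇ X (Y ⊕ ⁅ u ⁆) ≡ disjointᵇ X Y
disjointᵇ-⊕⁅⁆ʳ (false ∷ X) (_ ∷ Y) zero _ = cong (disjointᵇ X) (⊕-identityʳ Y)
disjointᵇ-⊕⁅⁆ʳ (x ∷ X) (y ∷ Y) (suc u) u∉X =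
  cong₂ _∧_ (cong (λ a → not (x ∧ a)) (xor-identityʳ y)) (disjointᵇ-⊕⁅⁆ʳ X Y u u∉X)

disjointᵇ-⊕⁅⁆ˡ : ∀ {n} (X Y : Subset n) u → lookup Y u ≡ false → disjointᵇ (X ⊕ ⁅ u ⁆) Y ≡ disjointᵇ X Y
disjointᵇ-⊕⁅⁆ˡ (x ∷ X) (false ∷ Y) zero _ =
  cong₂ _∧_ (cong not (trans (∧-zeroʳ (x xor true)) (sym (∧-zeroʳ x))))
            (cong (λ W → disjointᵇ W Y) (⊕-identityʳ X))
disjointᵇ-⊕⁅⁆ˡ (x ∷ X) (y ∷ Y) (suc u) u∉Y =
  cong₂ _∧_ (cong (λ a → not (a ∧ y)) (xor-identityʳ x)) (disjointᵇ-⊕⁅⁆ˡ X Y u u∉Y)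

disjointᵇ-∈ : ∀ {n} (X Y : Subset n) u → lookup X u ≡ true → lookup Y u ≡ true → disjointᵇ X Y ≡ false
disjointᵇ-∈ (true ∷ X) (true ∷ Y) zero _ _ = refl
disjointᵇ-∈ (x ∷ X) (y ∷ Y) (suc u) u∈X u∈Y =
  trans (cong (not (x ∧ y) ∧_) (disjointᵇ-∈ X Y u u∈X u∈Y)) (∧-zeroʳ _)

module _ {n} {v : Subset n} (X Y : Subset n) (u : Fin n) (u∉X : lookup X u ≡ false) (u∉Y : lookup Y u ≡ false) where

  admissible-minus : admissible v X Y ≡ admissible (v - u) X Y
  admissible-minus =
    cong₂ (λ a b → a ∧ b ∧ disjointᵇ X Y) (sym (⊆ᵇ-minus X v u u∉X)) (sym (⊆ᵇ-minus Y v u u∉Y))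

  module _ (u∈v : lookup v u ≡ true) where

    admissible-⊕⁅⁆ʳ : admissible v X (Y ⊕ ⁅ u ⁆) ≡ admissible (v - u) X Y
    admissible-⊕⁅⁆ʳ = cong₂ (λ a b → a ∧ b) (sym (⊆ᵇ-minus X v u u∉X))
      (cong₂ _∧_ (trans (⊆ᵇ-⊕⁅⁆ Y v u u∉Y u∈v) (sym (⊆ᵇ-minus Y v u u∉Y))) (disjointᵇ-⊕⁅⁆ʳ X Y u u∉X))

    admissible-⊕⁅⁆ˡ : admissible v (X ⊕ ⁅ u ⁆) Y ≡ admissible (v - u) X Y
    admissible-⊕⁅⁆ˡ = cong₂ (λ a b → a ∧ b) (trans (⊆ᵇ-⊕⁅⁆ X v u u∉X u∈v) (sym (⊆ᵇ-minus X v u u∉X)))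
      (cong₂ _∧_ (sym (⊆ᵇ-minus Y v u u∉Y)) (disjointᵇ-⊕⁅⁆ˡ X Y u u∉Y))

  admissible-⊕⁅⁆-both : admissible v (X ⊕ ⁅ u ⁆) (Y ⊕ ⁅ u ⁆) ≡ false
  admissible-⊕⁅⁆-both = trans (cong (λ b → ((X ⊕ ⁅ u ⁆) ⊆ᵇ v) ∧ ((Y ⊕ ⁅ u ⁆) ⊆ᵇ v) ∧ b)
      (disjointᵇ-∈ (X ⊕ ⁅ u ⁆) (Y ⊕ ⁅ u ⁆) u (trans (lookup-⊕⁅⁆-self X u) (cong not u∉X))
                                            (trans (lookup-⊕⁅⁆-self Y u) (cong not u∉Y))))
    (trans (cong (((X ⊕ ⁅ u ⁆) ⊆ᵇ v) ∧_) (∧-zeroʳ _)) (∧-zeroʳ _))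

admissible-∉ : ∀ {n} {v : Subset n} {u} X Y → lookup v u ≡ false → lookup X u ≡ true ⊎ lookup Y u ≡ true →
  admissible v X Y ≡ false
admissible-∉ {v = v} {u} X Y u∉v (inj₁ u∈X) =
  cong (λ a → a ∧ (Y ⊆ᵇ v) ∧ disjointᵇ X Y) (⊆ᵇ-∉ X v u u∈X u∉v)
admissible-∉ {v = v} {u} X Y u∉v (inj₂ u∈Y) =
  trans (cong (λ b → (X ⊆ᵇ v) ∧ b ∧ disjointᵇ X Y) (⊆ᵇ-∉ Y v u u∈Y u∉v)) (∧-zeroʳ _)

guarded-power-cong : ∀ y {c c′ : Bool} {k k′} → c ≡ c′ → (c′ ≡ true → k ≡ k′) →
  (if c then y ^ k else 0) ≡ (if c′ then y ^ k′ else 0)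
guarded-power-cong y {c′ = true} refl k≡k′ = cong (y ^_) (k≡k′ refl)
guarded-power-cong y {c′ = false} refl _ = refl

module _ {n} (v : Subset n) (d : Family n) (y : ℕ) (u : Fin n) where

  private
    T = Q₁-term v d y

  Q₁-split : Q₁ (v , d) y ≡ Σ²∌ u (λ X Y → T X Y + T X (Y ⊕ ⁅ u ⁆) + T (X ⊕ ⁅ u ⁆) Y)
  Q₁-split = trans (Q₁-double-sum v d y) (trans (Σˢ-pairs u (λ X → Σˢ (T X)))
               (Σˢ-cong λ X → unless-cong (lookup X u) (row X)))
    where
    corner : ∀ X Y → lookup X u ≡ false → lookup Y u ≡ false → T (X ⊕ ⁅ u ⁆) (Y ⊕ ⁅ u ⁆) ≡ 0
    corner X Y u∉X u∉Y = cong (λ c → if c then y ^ distᶠ (twist d (X ⊕ ⁅ u ⁆) (Y ⊕ ⁅ u ⁆)) else 0)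
                              (admissible-⊕⁅⁆-both {v = v} X Y u u∉X u∉Y)
    cell : ∀ X Y → lookup X u ≡ false →
      unless (lookup Y u) (T X Y + T X (Y ⊕ ⁅ u ⁆))
        + unless (lookup Y u) (T (X ⊕ ⁅ u ⁆) Y + T (X ⊕ ⁅ u ⁆) (Y ⊕ ⁅ u ⁆))
        ≡ unless (lookup Y u) (T X Y + T X (Y ⊕ ⁅ u ⁆) + T (X ⊕ ⁅ u ⁆) Y)
    cell X Y u∉X with lookup Y u in u∉Y
    ... | true = refl
    ... | false = cong (T X Y + T X (Y ⊕ ⁅ u ⁆) +_)
                    (trans (cong (T (X ⊕ ⁅ u ⁆) Y +_) (corner X Y u∉X u∉Y)) (+-identityʳ _))
    row : ∀ X → lookup X u ≡ false →
      Σˢ (T X) + Σˢ (T (X ⊕ ⁅ u ⁆))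
        ≡ Σˢ λ Y → unless (lookup Y u) (T X Y + T X (Y ⊕ ⁅ u ⁆) + T (X ⊕ ⁅ u ⁆) Y)
    row X u∉X = trans (cong₂ _+_ (Σˢ-pairs u (T X)) (Σˢ-pairs u (T (X ⊕ ⁅ u ⁆))))
      (trans (sym (Σˢ-+ (λ Y → unless (lookup Y u) (T X Y + T X (Y ⊕ ⁅ u ⁆)))
                        (λ Y → unless (lookup Y u) (T (X ⊕ ⁅ u ⁆) Y + T (X ⊕ ⁅ u ⁆) (Y ⊕ ⁅ u ⁆)))))
             (Σˢ-cong λ Y → cell X Y u∉X))

  Q₁-avoiding : lookup v u ≡ false → Q₁ (v , d) y ≡ Σ²∌ u T
  Q₁-avoiding u∉v = trans (Q₁-double-sum v d y) (Σˢ-cong row)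
    where
    vanishes : ∀ X Y → lookup X u ≡ true ⊎ lookup Y u ≡ true → T X Y ≡ 0
    vanishes X Y u∈X⊎Y = cong (λ c → if c then y ^ distᶠ (twist d X Y) else 0) (admissible-∉ {v = v} X Y u∉v u∈X⊎Y)
    row : ∀ X → Σˢ (T X) ≡ unless (lookup X u) (Σˢ λ Y → unless (lookup Y u) (T X Y))
    row X with lookup X u in u∈X
    ... | true = Σˢ-zero (T X) (λ Y → vanishes X Y (inj₁ u∈X))
    ... | false = Σˢ-cong cell
      where
      cell : ∀ Y → T X Y ≡ unless (lookup Y u) (T X Y)
      cell Y with lookup Y u in u∈Y
      ... | true = vanishes X Y (inj₂ u∈Y)
      ... | false = refl

⊥-admissible : ∀ {n} → admissible (⊥ {n}) ⊥ ⊥ ≡ true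
⊥-admissible {zero} = refl
⊥-admissible {suc n} = ⊥-admissible {n}

twist-⊥ : ∀ {n} (g : Family n) → twist g ⊥ ⊥ ≈ g
twist-⊥ {n} g Z = trans (cong (λ e → e Z) (no-dualPivots (allFin n))) (cong g (⊕-identityʳ Z))
  where
  no-dualPivots : ∀ L → dualPivotsᶠ (pivotD g ⊥) ⊥ L ≡ pivotD g ⊥
  no-dualPivots [] = refl
  no-dualPivots (w ∷ L) rewrite lookup-replicate {n = n} w false = no-dualPivots L

Q₁-⊥ : ∀ {n} (g : Family n) y → g ⊥ ≡ true → Q₁ (⊥ , g) y ≡ 1
Q₁-⊥ {n} g y g⊥ = begin
  Q₁ (⊥ , g) y             ≡⟨ Q₁-double-sum ⊥ g y ⟩
  Σˢ (λ X → Σˢ (T X))      ≡⟨ Σˢ-⊥ (λ X → Σˢ (T X)) (λ X X⊈⊥ → Σˢ-zero (T X) (λ Y → vanishes X Y (inj₁ X⊈⊥))) ⟩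
  Σˢ (T ⊥)                 ≡⟨ Σˢ-⊥ (T ⊥) (λ Y Y⊈⊥ → vanishes ⊥ Y (inj₂ Y⊈⊥)) ⟩
  T ⊥ ⊥                    ≡⟨ cong (λ c → if c then y ^ distᶠ (twist g ⊥ ⊥) else 0) (⊥-admissible {n}) ⟩
  y ^ distᶠ (twist g ⊥ ⊥)  ≡⟨ cong (y ^_) (trans (distᶠ-cong (twist-⊥ g)) dist-0) ⟩
  1                        ∎
  where
  open ≡-Reasoning
  T = Q₁-term ⊥ g y
  vanishes : ∀ X Y → X ⊆ᵇ ⊥ ≡ false ⊎ Y ⊆ᵇ ⊥ ≡ false → T X Y ≡ 0
  vanishes X Y X⊈⊥⊎Y⊈⊥ = cong (λ c → if c then y ^ distᶠ (twist g X Y) else 0) (inadmissible X⊈⊥⊎Y⊈⊥)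
    where
    inadmissible : X ⊆ᵇ ⊥ ≡ false ⊎ Y ⊆ᵇ ⊥ ≡ false → admissible ⊥ X Y ≡ false
    inadmissible (inj₁ X⊈⊥) = cong (λ a → a ∧ (Y ⊆ᵇ ⊥) ∧ disjointᵇ X Y) X⊈⊥
    inadmissible (inj₂ Y⊈⊥) = trans (cong (λ b → (X ⊆ᵇ ⊥) ∧ b ∧ disjointᵇ X Y) Y⊈⊥) (∧-zeroʳ _)
  dist-0 : distᶠ g ≡ 0
  dist-0 = n≤0⇒n≡0 (≤-trans (distᶠ-≤ g ⊥ g⊥) (≤-reflexive (∣⊥∣≡0 n)))

-- Δ-matroids

IsΔᶠ : ∀ {n} → Family n → Set
IsΔᶠ d = IsΔMatroid (⊥ , d)

Exchange : ∀ {n} → Family n → Subset n → Subset n → Fin n → Set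
Exchange d X Y w =
  d (X ⊕ ⁅ w ⁆) ≡ true ⊎ ∃ λ v → v ∈ (X ⊕ Y) × v ≢ w × d (X ⊕ (⁅ w ⁆ ∪ ⁅ v ⁆)) ≡ true

Δ-cong : ∀ {n} {d e : Family n} → d ≈ e → IsΔᶠ d → IsΔᶠ e
Δ-cong {d = d} {e} d≈e ((Z , dZ) , exchange) =
  (Z , trans (sym (d≈e Z)) dZ) , λ X Y eX eY w w∈X⊕Y →
    transport (exchange X Y (trans (d≈e X) eX) (trans (d≈e Y) eY) w w∈X⊕Y)
  where
  transport : ∀ {X Y w} → Exchange d X Y w → Exchange e X Y w
  transport (inj₁ dX⊕w) = inj₁ (trans (sym (d≈e _)) dX⊕w)
  transport (inj₂ (v , v∈X⊕Y , v≢w , dX⊕wv)) = inj₂ (v , v∈X⊕Y , v≢w , trans (sym (d≈e _)) dX⊕wv)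

Δ-pivot : ∀ {n} {d : Family n} S → IsΔᶠ d → IsΔᶠ (pivotD d S)
Δ-pivot {d = d} S ((Z , dZ) , exchange) =
  (Z ⊕ S , subst (λ W → d W ≡ true) (sym (⊕-cancelʳ Z S)) dZ) , λ X Y dX⊕S dY⊕S w w∈X⊕Y →
    transport (exchange (X ⊕ S) (Y ⊕ S) dX⊕S dY⊕S w (subst (w ∈_) (sym (⊕-cancel-middle X Y S)) w∈X⊕Y))
  where
  transport : ∀ {X Y w} → Exchange d (X ⊕ S) (Y ⊕ S) w → Exchange (pivotD d S) X Y w
  transport {X} {Y} {w} (inj₁ member) = inj₁ (subst (λ W → d W ≡ true) (⊕-swap X S ⁅ w ⁆) member)
  transport {X} {Y} {w} (inj₂ (v , v∈ , v≢w , member)) =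
    inj₂ (v , subst (v ∈_) (⊕-cancel-middle X Y S) v∈ , v≢w ,
          subst (λ W → d W ≡ true) (⊕-swap X S (⁅ w ⁆ ∪ ⁅ v ⁆)) member)

⊆ᵇ-lookup : ∀ {n} (X v : Subset n) w → X ⊆ᵇ v ≡ true → lookup X w ≡ true → lookup v w ≡ true
⊆ᵇ-lookup (true ∷ X) (true ∷ v) zero _ _ = refl
⊆ᵇ-lookup (true ∷ X) (true ∷ v) (suc w) X⊆v w∈X = ⊆ᵇ-lookup X v w X⊆v w∈X
⊆ᵇ-lookup (false ∷ X) (b ∷ v) (suc w) X⊆v w∈X = ⊆ᵇ-lookup X v w X⊆v w∈X

disjointᵇ-lookup : ∀ {n} (X S : Subset n) w → disjointᵇ X S ≡ true → lookup X w ≡ true → lookup S w ≡ false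
disjointᵇ-lookup (true ∷ X) (false ∷ S) zero _ _ = refl
disjointᵇ-lookup (true ∷ X) (false ∷ S) (suc w) X∩S w∈X = disjointᵇ-lookup X S w X∩S w∈X
disjointᵇ-lookup (false ∷ X) (s ∷ S) (suc w) X∩S w∈X = disjointᵇ-lookup X S w X∩S w∈X

dualPivotOps : ∀ {n} → Subset n → List (Fin n) → List (ElemOp n)
dualPivotOps X [] = []
dualPivotOps X (w ∷ L) = dualPivotOps X L ++ (if lookup X w then loop w ∷ piv w ∷ loop w ∷ [] else [])

applySeq-++ : ∀ {n} (M : RawSS n) φ ψ → applySeq M (φ ++ ψ) ≡ applySeq (applySeq M φ) ψ
applySeq-++ M [] ψ = refl
applySeq-++ M (o ∷ φ) ψ = applySeq-++ (applyOp M o) φ ψ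

applySeq-dualPivotOps : ∀ {n} (M : RawSS n) X L → proj₂ (applySeq M (dualPivotOps X L)) ≡ dualPivotsᶠ (proj₂ M) X L
applySeq-dualPivotOps M X [] = refl
applySeq-dualPivotOps M X (w ∷ L)
  rewrite applySeq-++ M (dualPivotOps X L) (if lookup X w then loop w ∷ piv w ∷ loop w ∷ [] else [])
  with lookup X w
... | true = cong (λ e → dualPivotᶠ e w) (applySeq-dualPivotOps M X L)
... | false = applySeq-dualPivotOps M X L

-- M * S *̄ X = (M *̄ X) * S as X ∩ S = ∅, and M *̄ X arises from M by operations on elements of X ⊆ V.
twist-Δ : ∀ {n} (M : SetSystem n) → VfClosedΔMatroid M → ∀ X S → admissible (V M) X S ≡ true →
  IsΔᶠ (twist (D M) X S)
twist-Δ {n} M vf-closed X S adm =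
  Δ-cong (commutes-dualPivots (λ d → pivotD d S) (λ d≈e → pivot-cong d≈e S) X (allFin n)
           (λ w w∈X → pivot-dualPivot S w (disjointᵇ-lookup X S w X∩S w∈X)) (D M))
    (Δ-pivot S (subst IsΔᶠ (applySeq-dualPivotOps (raw M) X (allFin n))
                      (vf-closed (dualPivotOps X (allFin n)) (ops-in-V (allFin n)))))
  where
  X⊆V : X ⊆ᵇ V M ≡ true
  X⊆V = ∧-conicalˡ (X ⊆ᵇ V M) _ adm
  X∩S : disjointᵇ X S ≡ true
  X∩S = ∧-conicalʳ (S ⊆ᵇ V M) _ (∧-conicalʳ (X ⊆ᵇ V M) _ adm)
  ops-in-V : ∀ L → All (λ o → opElem o ∈ V M) (dualPivotOps X L)
  ops-in-V [] = []
  ops-in-V (w ∷ L) = ++⁺ (ops-in-V L) last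
    where
    last : All (λ o → opElem o ∈ V M) (if lookup X w then loop w ∷ piv w ∷ loop w ∷ [] else [])
    last with lookup X w in w∈X
    ... | true = let w∈V = lookup⇒[]= w (V M) (⊆ᵇ-lookup X (V M) w X⊆V w∈X) in w∈V ∷ w∈V ∷ w∈V ∷ []
    ... | false = []

-- Distances of deletions, pivots and dual pivots

HasMemberAvoiding : ∀ {n} → Family n → Fin n → Set
HasMemberAvoiding d u = ∃ λ Z → d Z ≡ true × lookup Z u ≡ false

AvoidableAtMinimum : ∀ {n} → Family n → Fin n → Set
AvoidableAtMinimum d u = ∀ Z → d Z ≡ true → lookup Z u ≡ true → (∀ W → d W ≡ true → ∣ Z ∣ ≤ ∣ W ∣) →
  ∃ λ Z′ → d Z′ ≡ true × lookup Z′ u ≡ false × ∣ Z′ ∣ ≤ ∣ Z ∣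

delete-member : ∀ {n} (d : Family n) u {Z} → d Z ≡ true → lookup Z u ≡ false → delD d u Z ≡ true
delete-member d u dZ u∉Z rewrite dZ | u∉Z = refl

dist-delete : ∀ {n} (d : Family n) u → HasMemberAvoiding d u → AvoidableAtMinimum d u →
  distᶠ (delD d u) ≡ distᶠ d
dist-delete d u (Z₀ , dZ₀ , _) avoidable =
  ≤-antisym ≤-dist (distᶠ-mono d (delD d u) (λ W dW → W , ∧-conicalˡ (d W) _ dW , ≤-refl))
  where
  ≤-dist : distᶠ (delD d u) ≤ distᶠ d
  ≤-dist with distᶠ-attained d (Z₀ , dZ₀)
  ... | Z , dZ , dist≡ with lookup Z u in u∈Z
  ...   | false = ≤-trans (distᶠ-≤ (delD d u) Z (delete-member d u dZ u∈Z)) (≤-reflexive (sym dist≡))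
  ...   | true with avoidable Z dZ u∈Z (λ W dW → subst (_≤ ∣ W ∣) dist≡ (distᶠ-≤ d W dW))
  ...     | Z′ , dZ′ , u∉Z′ , Z′≤Z =
            ≤-trans (distᶠ-≤ (delD d u) Z′ (delete-member d u dZ′ u∉Z′))
                    (≤-trans Z′≤Z (≤-reflexive (sym dist≡)))

-- Exchanging u between Z and a member avoiding u yields Z ⊕ ⁅ u ⁆ or Z ⊕ ⁅ u ⁆ ⊕ ⁅ v ⁆; minimality of Z
-- leaves only the latter with v ∉ Z.
Δ-avoidable : ∀ {n} {d : Family n} u → IsΔᶠ d → HasMemberAvoiding d u → AvoidableAtMinimum d u
Δ-avoidable {d = d} u (_ , exchange) (Y , dY , u∉Y) Z dZ u∈Z minimum
  with exchange Z Y dZ dY u (lookup⇒[]= u (Z ⊕ Y) (trans (lookup-⊕ Z Y u) (cong₂ _xor_ u∈Z u∉Y)))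
... | inj₁ dZ⊕u =
  ⊥-elim (1+n≰n (subst (_≤ ∣ Z ⊕ ⁅ u ⁆ ∣) (sym (card-⊕⁅⁆-∈ Z u u∈Z)) (minimum _ dZ⊕u)))
... | inj₂ (v , _ , v≢u , dZ⊕uv) with lookup Z v in v∈Z
...   | true = ⊥-elim (1+n≰n (≤-trans (n≤1+n _) (subst (_≤ ∣ W ⊕ ⁅ v ⁆ ∣) (sym shrinks) (minimum _ dW⊕v))))
  where
  W = Z ⊕ ⁅ u ⁆
  dW⊕v : d (W ⊕ ⁅ v ⁆) ≡ true
  dW⊕v = subst (λ T → d T ≡ true) (⊕-pair Z v≢u) dZ⊕uv
  shrinks : suc (suc ∣ W ⊕ ⁅ v ⁆ ∣) ≡ ∣ Z ∣
  shrinks = trans (cong suc (card-⊕⁅⁆-∈ W v (trans (lookup-⊕⁅⁆-other Z u v≢u) v∈Z))) (card-⊕⁅⁆-∈ Z u u∈Z)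
...   | false = W ⊕ ⁅ v ⁆ , dW⊕v , u∉W⊕v , ≤-reflexive sizes
  where
  W = Z ⊕ ⁅ u ⁆
  dW⊕v : d (W ⊕ ⁅ v ⁆) ≡ true
  dW⊕v = subst (λ T → d T ≡ true) (⊕-pair Z v≢u) dZ⊕uv
  u∉W⊕v : lookup (W ⊕ ⁅ v ⁆) u ≡ false
  u∉W⊕v = trans (lookup-⊕⁅⁆-other W v (≢-sym v≢u)) (trans (lookup-⊕⁅⁆-self Z u) (cong not u∈Z))
  sizes : ∣ W ⊕ ⁅ v ⁆ ∣ ≡ ∣ Z ∣
  sizes = trans (card-⊕⁅⁆-∉ W v (trans (lookup-⊕⁅⁆-other Z u v≢u) v∈Z)) (card-⊕⁅⁆-∈ Z u u∈Z)

Uniform : ∀ {n} → Bool → Family n → Fin n → Set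
Uniform b d u = ∀ Z → d Z ≡ true → lookup Z u ≡ b

Loop Coloop : ∀ {n} → Family n → Fin n → Set
Loop = Uniform false
Coloop = Uniform true

dist-pivot-loop : ∀ {n} (d : Family n) u → NonEmpty d → Loop d u → distᶠ (pivotD d ⁅ u ⁆) ≡ suc (distᶠ d)
dist-pivot-loop d u (Z₀ , dZ₀) u-loop = ≤-antisym upper lower
  where
  member : ∀ {Z} → d Z ≡ true → pivotD d ⁅ u ⁆ (Z ⊕ ⁅ u ⁆) ≡ true
  member {Z} dZ = subst (λ T → d T ≡ true) (sym (⊕-cancelʳ Z ⁅ u ⁆)) dZ
  upper : distᶠ (pivotD d ⁅ u ⁆) ≤ suc (distᶠ d)
  upper with distᶠ-attained d (Z₀ , dZ₀)
  ... | Z , dZ , dist≡ = ≤-trans (distᶠ-≤ (pivotD d ⁅ u ⁆) (Z ⊕ ⁅ u ⁆) (member dZ))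
                                  (≤-reflexive (trans (card-⊕⁅⁆-∉ Z u (u-loop Z dZ)) (cong suc (sym dist≡))))
  lower : suc (distᶠ d) ≤ distᶠ (pivotD d ⁅ u ⁆)
  lower with distᶠ-attained (pivotD d ⁅ u ⁆) (Z₀ ⊕ ⁅ u ⁆ , member dZ₀)
  ... | W , dW⊕u , dist≡ = ≤-trans (s≤s (distᶠ-≤ d (W ⊕ ⁅ u ⁆) dW⊕u))
    (≤-reflexive (trans (card-⊕⁅⁆-∈ W u (not-injective (trans (sym (lookup-⊕⁅⁆-self W u)) (u-loop _ dW⊕u))))
                        (sym dist≡)))

module _ {n} (N : Family n) {u : Fin n} where

  dualPivot-∉ : ∀ {Z} → lookup Z u ≡ false → dualPivotᶠ N u Z ≡ N (Z ⊕ ⁅ u ⁆) xor N Z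
  dualPivot-∉ {Z} u∉Z rewrite lookup-⊕⁅⁆-self Z u | u∉Z
    | trans (minus-∈ (Z ⊕ ⁅ u ⁆) u (∈-⊕⁅⁆-∉ Z u u∉Z)) (⊕-cancelʳ Z ⁅ u ⁆) = xor-identityʳ _

  dualPivot-∈ : ∀ {Z} → lookup Z u ≡ true → dualPivotᶠ N u Z ≡ N Z
  dualPivot-∈ {Z} u∈Z rewrite lookup-⊕⁅⁆-self Z u | u∈Z
    | trans (cong (_⊕ ⁅ u ⁆) (minus-∈ Z u u∈Z)) (⊕-cancelʳ Z ⁅ u ⁆) | minus-∈ Z u u∈Z | u∈Z =
    solve 2 (λ a b → (b :+ con false) :+ (a :+ b) := a) refl (N Z) (N (Z ⊕ ⁅ u ⁆))

Free : ∀ {n} → Family n → Fin n → Set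
Free g u = ∀ Z → g (Z ⊕ ⁅ u ⁆) ≡ g Z

delete-loop-≈ : ∀ {n} (N : Family n) u → Loop N u → delD N u ≈ N
delete-loop-≈ N u u-loop Z with N Z in NZ
... | true rewrite u-loop Z NZ = refl
... | false = refl

Loop-delete : ∀ {n} (N : Family n) u → Loop (delD N u) u
Loop-delete N u Z member = not-injective (∧-conicalʳ (N Z) _ member)

Free-avoiding : ∀ {n} (N : Family n) u → NonEmpty N → Free N u → HasMemberAvoiding N u
Free-avoiding N u (Z , NZ) free = case-on-membership Z u
  (λ u∈Z → Z ⊕ ⁅ u ⁆ , trans (free Z) NZ , ∉-⊕⁅⁆-∈ Z u u∈Z) (λ u∉Z → Z , NZ , u∉Z)

NonEmpty-delete : ∀ {n} (N : Family n) u → HasMemberAvoiding N u → NonEmpty (delD N u)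
NonEmpty-delete N u (Z , NZ , u∉Z) = Z , delete-member N u NZ u∉Z

module _ {n} (N : Family n) (u : Fin n) (nonempty : NonEmpty N) where

  module _ (free : Free N u) where

    private
      avoiding : HasMemberAvoiding N u
      avoiding = Free-avoiding N u nonempty free

    free-dist : distᶠ (delD N u) ≡ distᶠ N
    free-dist = dist-delete N u avoiding λ Z NZ u∈Z _ →
      Z ⊕ ⁅ u ⁆ , trans (free Z) NZ , ∉-⊕⁅⁆-∈ Z u u∈Z ,
      ≤-trans (n≤1+n _) (≤-reflexive (card-⊕⁅⁆-∈ Z u u∈Z))

    free-dist-pivot : distᶠ (pivotD N ⁅ u ⁆) ≡ distᶠ N
    free-dist-pivot = distᶠ-cong free

    free-dist-dualPivot : distᶠ (dualPivotᶠ N u) ≡ suc (distᶠ (delD N u))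
    free-dist-dualPivot = trans (distᶠ-cong dual≈) (dist-pivot-loop (delD N u) u nonempty-delete (Loop-delete N u))
      where
      nonempty-delete : NonEmpty (delD N u)
      nonempty-delete = NonEmpty-delete N u avoiding
      dual≈ : dualPivotᶠ N u ≈ pivotD (delD N u) ⁅ u ⁆
      dual≈ Z = case-on-membership Z u contains omits
        where
        open ≡-Reasoning
        omits : lookup Z u ≡ false → dualPivotᶠ N u Z ≡ pivotD (delD N u) ⁅ u ⁆ Z
        omits u∉Z = begin
          dualPivotᶠ N u Z            ≡⟨ dualPivot-∉ N u∉Z ⟩
          N (Z ⊕ ⁅ u ⁆) xor N Z       ≡⟨ cong (_xor N Z) (free Z) ⟩
          N Z xor N Z                 ≡⟨ xor-same (N Z) ⟩
          false                       ≡⟨ sym (∧-zeroʳ _) ⟩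
          N (Z ⊕ ⁅ u ⁆) ∧ false       ≡⟨ cong (λ b → N (Z ⊕ ⁅ u ⁆) ∧ not b) (sym (∈-⊕⁅⁆-∉ Z u u∉Z)) ⟩
          pivotD (delD N u) ⁅ u ⁆ Z   ∎
        contains : lookup Z u ≡ true → dualPivotᶠ N u Z ≡ pivotD (delD N u) ⁅ u ⁆ Z
        contains u∈Z = begin
          dualPivotᶠ N u Z            ≡⟨ dualPivot-∈ N u∈Z ⟩
          N Z                         ≡⟨ sym (trans (∧-identityʳ _) (free Z)) ⟩
          N (Z ⊕ ⁅ u ⁆) ∧ true        ≡⟨ cong (λ b → N (Z ⊕ ⁅ u ⁆) ∧ not b) (sym (∉-⊕⁅⁆-∈ Z u u∈Z)) ⟩
          pivotD (delD N u) ⁅ u ⁆ Z   ∎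

  module _ (u-loop : Loop N u) where

    loop-dist-pivot : distᶠ (pivotD N ⁅ u ⁆) ≡ suc (distᶠ N)
    loop-dist-pivot = dist-pivot-loop N u nonempty u-loop

    loop-dist-dualPivot : distᶠ (dualPivotᶠ N u) ≡ distᶠ N
    loop-dist-dualPivot = distᶠ-cong λ Z → case-on-membership Z u (dualPivot-∈ N)
      λ u∉Z → trans (dualPivot-∉ N u∉Z) (cong (_xor N Z) (¬-not (λ N[Z⊕u] →
        not-¬ (∈-⊕⁅⁆-∉ Z u u∉Z) (u-loop (Z ⊕ ⁅ u ⁆) N[Z⊕u]))))

Coloop-pivot : ∀ {n} (N : Family n) u → Coloop N u → Loop (pivotD N ⁅ u ⁆) u
Coloop-pivot N u u-coloop Z N[Z⊕u] =
  not-injective (trans (sym (lookup-⊕⁅⁆-self Z u)) (u-coloop (Z ⊕ ⁅ u ⁆) N[Z⊕u]))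

module _ {n} (N : Family n) (u : Fin n) (nonempty : NonEmpty N) (u-coloop : Coloop N u) where

  private
    P = pivotD N ⁅ u ⁆
    nonempty-P : NonEmpty P
    nonempty-P = let (Z , NZ) = nonempty in Z ⊕ ⁅ u ⁆ , trans (cong N (⊕-cancelʳ Z ⁅ u ⁆)) NZ

  coloop-dist : distᶠ N ≡ suc (distᶠ P)
  coloop-dist = trans (distᶠ-cong (λ Z → cong N (sym (⊕-cancelʳ Z ⁅ u ⁆))))
                      (dist-pivot-loop P u nonempty-P (Coloop-pivot N u u-coloop))

  coloop-dist-dualPivot : distᶠ (dualPivotᶠ N u) ≡ distᶠ P
  coloop-dist-dualPivot = ≤-antisym (distᶠ-mono (dualPivotᶠ N u) P from-P) (distᶠ-mono P (dualPivotᶠ N u) to-P)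
    where
    N-omitting : ∀ {W} → lookup W u ≡ false → N W ≡ false
    N-omitting u∉W = ¬-not λ NW → not-¬ u∉W (u-coloop _ NW)
    from-P : ∀ W → P W ≡ true → ∃ λ W′ → dualPivotᶠ N u W′ ≡ true × ∣ W′ ∣ ≤ ∣ W ∣
    from-P W PW = W , trans (dualPivot-∉ N u∉W) (cong₂ _xor_ PW (N-omitting u∉W)) , ≤-refl
      where
      u∉W = Coloop-pivot N u u-coloop W PW
    to-P : ∀ W → dualPivotᶠ N u W ≡ true → ∃ λ W′ → P W′ ≡ true × ∣ W′ ∣ ≤ ∣ W ∣
    to-P W dual-W = case-on-membership W u
      (λ u∈W → W ⊕ ⁅ u ⁆ , trans (cong N (⊕-cancelʳ W ⁅ u ⁆)) (trans (sym (dualPivot-∈ N u∈W)) dual-W) ,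
               ≤-trans (n≤1+n _) (≤-reflexive (card-⊕⁅⁆-∈ W u u∈W)))
      (λ u∉W → W , trans (sym (xor-identityʳ (P W)))
                         (trans (cong (P W xor_) (sym (N-omitting u∉W))) (trans (sym (dualPivot-∉ N u∉W)) dual-W)) ,
               ≤-refl)

-- Properties that survive operations away from u

StableOff : ∀ {n} → (Family n → Set) → Fin n → Set
StableOff {n} Q u =
  (∀ (g : Family n) S → lookup S u ≡ false → Q g → Q (pivotD g S)) ×
  (∀ (g : Family n) w → w ≢ u → Q g → Q (loopD g w))

twist-stable : ∀ {n} {Q : Family n → Set} {u} → StableOff Q u →
  ∀ g X S → lookup X u ≡ false → lookup S u ≡ false → Q g → Q (twist g X S)
twist-stable {n} {Q} {u} (pivot-stable , loop-stable) g X S u∉X u∉S Qg =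
  dualPivots-stable (allFin n) (pivot-stable g S u∉S Qg)
  where
  dualPivots-stable : ∀ L {e} → Q e → Q (dualPivotsᶠ e X L)
  dualPivots-stable [] Qe = Qe
  dualPivots-stable (w ∷ L) Qe with lookup X w in w∈X
  ... | true = loop-stable _ w w≢u (pivot-stable _ ⁅ w ⁆ (lookup-⁅⁆-other w (≢-sym w≢u))
                                     (loop-stable _ w w≢u (dualPivots-stable L Qe)))
    where
    w≢u : w ≢ u
    w≢u = ≢-of-∉ {X = X} u∉X w∈X
  ... | false = dualPivots-stable L Qe

NonEmpty-loop : ∀ {n} (g : Family n) w → NonEmpty g → NonEmpty (loopD g w)
NonEmpty-loop g w (Z , gZ) with lookup Z w in w∈Z | g (Z - w) in gZ-w
... | false | _ = Z , cong₂ (λ a b → a xor (b ∧ g (Z - w))) gZ w∈Z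
... | true | false = Z , trans (cong₂ (λ a b → a xor (b ∧ g (Z - w))) gZ w∈Z) (cong not gZ-w)
... | true | true = Z - w , cong₂ (λ a b → a xor (b ∧ g ((Z - w) - w))) gZ-w (lookup-minus-self Z w)

NonEmpty-stable : ∀ {n} (u : Fin n) → StableOff NonEmpty u
NonEmpty-stable u = (λ g S _ → λ { (Z , gZ) → Z ⊕ S , subst (λ T → g T ≡ true) (sym (⊕-cancelʳ Z S)) gZ }) ,
                    (λ g w _ → NonEmpty-loop g w)

Uniform-stable : ∀ {n} b (u : Fin n) → StableOff (λ g → Uniform b g u) u
Uniform-stable b u = (λ g S u∉S uniform Z gZ⊕S → trans (sym (lookup-⊕-∉ Z S u u∉S)) (uniform (Z ⊕ S) gZ⊕S)) ,
                     loop-case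
  where
  loop-case : ∀ g w → w ≢ u → Uniform b g u → Uniform b (loopD g w) u
  loop-case g w w≢u uniform Z loop-gZ with g Z in gZ
  ... | true = uniform Z gZ
  ... | false = trans (sym (lookup-minus-other Z w (≢-sym w≢u))) (uniform (Z - w) (∧-conicalʳ (lookup Z w) _ loop-gZ))

Free-stable : ∀ {n} (u : Fin n) → StableOff (λ g → Free g u) u
Free-stable u = (λ g S _ free Z → trans (cong g (⊕-swap Z ⁅ u ⁆ S)) (free (Z ⊕ S))) , loop-case
  where
  loop-case : ∀ g w → w ≢ u → Free g u → Free (loopD g w) u
  loop-case g w w≢u free Z
    rewrite lookup-⊕⁅⁆-other Z u w≢u | sym (minus-⊕-comm Z w ⁅ u ⁆ (lookup-⁅⁆-other u w≢u))
          | free Z | free (Z - w) = refl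

-- Strong divisibility of families

module _ {n} (u : Fin n) where

  omitting including splitting : Family n → Family n
  omitting g Z = g (Z - u)
  including g Z = g (Z ∪ ⁅ u ⁆)
  splitting g Z = g (Z - u) xor g (Z ∪ ⁅ u ⁆)

  StronglyDivisibleᶠ : Family n → Set
  StronglyDivisibleᶠ g = NonEmpty (omitting g) × NonEmpty (including g) × NonEmpty (splitting g)

  module _ (g : Family n) where

    module _ {S} (u∉S : lookup S u ≡ false) where

      omitting-pivot : omitting (pivotD g S) ≈ pivotD (omitting g) S
      omitting-pivot Z = cong g (minus-⊕-comm Z u S u∉S)

      including-pivot : including (pivotD g S) ≈ pivotD (including g) S
      including-pivot Z = cong g (∪⁅⁆-⊕-comm Z u S u∉S)

      splitting-pivot : splitting (pivotD g S) ≈ pivotD (splitting g) S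
      splitting-pivot Z = cong₂ _xor_ (omitting-pivot Z) (including-pivot Z)

    module _ {w} (w≢u : w ≢ u) where

      omitting-loop : omitting (loopD g w) ≈ loopD (omitting g) w
      omitting-loop Z rewrite lookup-minus-other Z u w≢u | p─x─y≡p─y─x Z u w = refl

      including-loop : including (loopD g w) ≈ loopD (including g) w
      including-loop Z rewrite lookup-∪⁅⁆-other Z u w≢u | ∪⁅⁆-minus-comm Z w≢u = refl

      splitting-loop : splitting (loopD g w) ≈ loopD (splitting g) w
      splitting-loop Z rewrite omitting-loop Z | including-loop Z =
        solve 5 (λ a b c e f → (a :+ (b :* c)) :+ (e :+ (b :* f)) := (a :+ e) :+ (b :* (c :+ f)))
          refl (g (Z - u)) (lookup Z w) (g ((Z - w) - u)) (g (Z ∪ ⁅ u ⁆)) (g ((Z - w) ∪ ⁅ u ⁆))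

  StronglyDivisibleᶠ-stable : StableOff StronglyDivisibleᶠ u
  StronglyDivisibleᶠ-stable = pivot-case , loop-case
    where
    pivot-stable = proj₁ (NonEmpty-stable u)
    pivot-case : ∀ g S → lookup S u ≡ false → StronglyDivisibleᶠ g → StronglyDivisibleᶠ (pivotD g S)
    pivot-case g S u∉S (o , i , s) =
      NonEmpty-cong (≈-sym (omitting-pivot g u∉S)) (pivot-stable _ S u∉S o) ,
      NonEmpty-cong (≈-sym (including-pivot g u∉S)) (pivot-stable _ S u∉S i) ,
      NonEmpty-cong (≈-sym (splitting-pivot g u∉S)) (pivot-stable _ S u∉S s)
    loop-case : ∀ g w → w ≢ u → StronglyDivisibleᶠ g → StronglyDivisibleᶠ (loopD g w)
    loop-case g w w≢u (o , i , s) =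
      NonEmpty-cong (≈-sym (omitting-loop g w≢u)) (NonEmpty-loop _ w o) ,
      NonEmpty-cong (≈-sym (including-loop g w≢u)) (NonEmpty-loop _ w i) ,
      NonEmpty-cong (≈-sym (splitting-loop g w≢u)) (NonEmpty-loop _ w s)

module _ {n} (g : Family n) (u : Fin n) (sd : StronglyDivisibleᶠ u g) where

  avoiding-member : HasMemberAvoiding g u
  avoiding-member with proj₁ sd
  ... | Z , gZ-u = Z - u , gZ-u , lookup-minus-self Z u

  avoiding-member-pivot : HasMemberAvoiding (pivotD g ⁅ u ⁆) u
  avoiding-member-pivot with proj₁ (proj₂ sd)
  ... | Z , gZ∪u = (Z ∪ ⁅ u ⁆) ⊕ ⁅ u ⁆ , trans (cong g (⊕-cancelʳ (Z ∪ ⁅ u ⁆) ⁅ u ⁆)) gZ∪u ,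
                   ∉-⊕⁅⁆-∈ (Z ∪ ⁅ u ⁆) u (lookup-∪⁅⁆-self Z u)

  avoiding-member-dualPivot : HasMemberAvoiding (dualPivotᶠ g u) u
  avoiding-member-dualPivot with proj₂ (proj₂ sd)
  ... | Z , split = Z - u , trans (dualPivot-∉ g (lookup-minus-self Z u))
                                  (trans (cong (λ T → g T xor g (Z - u)) (minus-⊕⁅⁆ Z u))
                                         (trans (xor-comm (g (Z ∪ ⁅ u ⁆)) (g (Z - u))) split)) ,
                    lookup-minus-self Z u

StronglyDivisibleBy⇒ᶠ : ∀ {n} (M : SetSystem n) u → StronglyDivisibleBy M u → StronglyDivisibleᶠ u (D M)
StronglyDivisibleBy⇒ᶠ M u ((X₁ , X₂ , X₁∈M , X₂∈M , u∈X₁⊕X₂) , (X , X∈M , X⊕u∉M)) =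
  proj₁ sides , proj₂ sides , split
  where
  g = D M
  omitting-of : ∀ {Z} → g Z ≡ true → lookup Z u ≡ false → NonEmpty (omitting u g)
  omitting-of {Z} gZ u∉Z = Z , trans (cong g (minus-∉ Z u u∉Z)) gZ
  including-of : ∀ {Z} → g Z ≡ true → lookup Z u ≡ true → NonEmpty (including u g)
  including-of {Z} gZ u∈Z = Z , trans (cong g (∪⁅⁆-∈ Z u u∈Z)) gZ
  sides : NonEmpty (omitting u g) × NonEmpty (including u g)
  sides with lookup X₁ u in u∈X₁ | lookup X₂ u in u∈X₂ | trans (sym (lookup-⊕ X₁ X₂ u)) ([]=⇒lookup u∈X₁⊕X₂)
  ... | true | false | _ = omitting-of X₂∈M u∈X₂ , including-of X₁∈M u∈X₁
  ... | false | true | _ = omitting-of X₁∈M u∈X₁ , including-of X₂∈M u∈X₂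
  gX⊕u : g (X ⊕ ⁅ u ⁆) ≡ false
  gX⊕u = ¬-not X⊕u∉M
  split : NonEmpty (splitting u g)
  split with lookup X u in u∈X
  ... | true = X , cong₂ _xor_ (trans (cong g (minus-∈ X u u∈X)) gX⊕u) (trans (cong g (∪⁅⁆-∈ X u u∈X)) X∈M)
  ... | false = X , cong₂ _xor_ (trans (cong g (minus-∉ X u u∈X)) X∈M) (trans (cong g (∪⁅⁆-∉ X u u∈X)) gX⊕u)

-- The strongly divisible case

dist-delete-Δ : ∀ {n} {F F′ : Family n} u → F ≈ F′ → IsΔᶠ F → HasMemberAvoiding F′ u →
  distᶠ F ≡ distᶠ (delD F′ u)
dist-delete-Δ u F≈F′ ΔF avoiding = trans (distᶠ-cong F≈F′)
  (sym (dist-delete _ u avoiding (Δ-avoidable u (Δ-cong F≈F′ ΔF) avoiding)))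

module _ {n} (M : SetSystem n) (vf-closed : VfClosedΔMatroid M) {u : Fin n} (u∈V : lookup (V M) u ≡ true)
         (sd : StronglyDivisibleᶠ u (D M)) where

  private
    v = V M
    d = D M

  module _ X Y (u∉X : lookup X u ≡ false) (u∉Y : lookup Y u ≡ false) (adm : admissible (v - u) X Y ≡ true) where

    private
      N = twist d X Y
      sdN : StronglyDivisibleᶠ u N
      sdN = twist-stable (StronglyDivisibleᶠ-stable u) d X Y u∉X u∉Y sd
      Δ-twist : ∀ X′ Y′ → admissible v X′ Y′ ≡ admissible (v - u) X Y → IsΔᶠ (twist d X′ Y′)
      Δ-twist X′ Y′ adm≡ = twist-Δ M vf-closed X′ Y′ (trans adm≡ adm)

    dist-deletion : distᶠ (twist d X Y) ≡ distᶠ (twist (delD d u) X Y)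
    dist-deletion =
      trans (dist-delete-Δ u (λ _ → refl) (Δ-twist X Y (admissible-minus X Y u u∉X u∉Y))
                           (avoiding-member N u sdN))
            (distᶠ-cong (≈-sym (twist-delete d X u u∉X Y u∉Y)))

    dist-pivot-deletion : distᶠ (twist d X (Y ⊕ ⁅ u ⁆)) ≡ distᶠ (twist (delD (pivotD d ⁅ u ⁆) u) X Y)
    dist-pivot-deletion =
      trans (dist-delete-Δ u (twist-⊕⁅⁆-right d X u u∉X Y)
                           (Δ-twist X (Y ⊕ ⁅ u ⁆) (admissible-⊕⁅⁆ʳ X Y u u∉X u∉Y u∈V))
                           (avoiding-member-pivot N u sdN))
            (distᶠ-cong (≈-sym (≈-trans (twist-delete (pivotD d ⁅ u ⁆) X u u∉X Y u∉Y)
                                        (delete-cong (twist-pivot d X u u∉X Y) u))))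

    dist-dualPivot-deletion : distᶠ (twist d (X ⊕ ⁅ u ⁆) Y) ≡ distᶠ (twist (delD (dualPivotᶠ d u) u) X Y)
    dist-dualPivot-deletion =
      trans (dist-delete-Δ u (twist-⊕⁅⁆-left d X u u∉X Y)
                           (Δ-twist (X ⊕ ⁅ u ⁆) Y (admissible-⊕⁅⁆ˡ X Y u u∉X u∉Y u∈V))
                           (avoiding-member-dualPivot N u sdN))
            (distᶠ-cong (≈-sym (≈-trans (twist-delete (dualPivotᶠ d u) X u u∉X Y u∉Y)
                                        (delete-cong (twist-dualPivot d X u u∉X Y u∉Y) u))))

  Q₁-recursion : ∀ y → Q₁ (v , d) y ≡ Q₁ (v - u , delD d u) y + Q₁ (v - u , delD (pivotD d ⁅ u ⁆) u) y
                                        + Q₁ (v - u , delD (dualPivotᶠ d u) u) y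
  Q₁-recursion y = begin
    Q₁ (v , d) y
      ≡⟨ Q₁-split v d y u ⟩
    Σ²∌ u (λ X Y → T X Y + T X (Y ⊕ ⁅ u ⁆) + T (X ⊕ ⁅ u ⁆) Y)
      ≡⟨ Σ²∌-cong u termwise ⟩
    Σ²∌ u (λ X Y → T₁ X Y + T₂ X Y + T₃ X Y)
      ≡⟨ trans (Σ²∌-+ u (λ X Y → T₁ X Y + T₂ X Y) T₃) (cong (_+ Σ²∌ u T₃) (Σ²∌-+ u T₁ T₂)) ⟩
    Σ²∌ u T₁ + Σ²∌ u T₂ + Σ²∌ u T₃
      ≡⟨ sym (cong₂ _+_ (cong₂ _+_ (Q₁-avoiding (v - u) (delD d u) y u u∉v-u)
                                   (Q₁-avoiding (v - u) (delD (pivotD d ⁅ u ⁆) u) y u u∉v-u))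
                         (Q₁-avoiding (v - u) (delD (dualPivotᶠ d u) u) y u u∉v-u)) ⟩
    Q₁ (v - u , delD d u) y + Q₁ (v - u , delD (pivotD d ⁅ u ⁆) u) y + Q₁ (v - u , delD (dualPivotᶠ d u) u) y ∎
    where
    open ≡-Reasoning
    u∉v-u = lookup-minus-self v u
    T = Q₁-term v d y
    T₁ = Q₁-term (v - u) (delD d u) y
    T₂ = Q₁-term (v - u) (delD (pivotD d ⁅ u ⁆) u) y
    T₃ = Q₁-term (v - u) (delD (dualPivotᶠ d u) u) y
    termwise : ∀ X Y → lookup X u ≡ false → lookup Y u ≡ false →
      T X Y + T X (Y ⊕ ⁅ u ⁆) + T (X ⊕ ⁅ u ⁆) Y ≡ T₁ X Y + T₂ X Y + T₃ X Y
    termwise X Y u∉X u∉Y = cong₂ _+_ (cong₂ _+_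
      (guarded-power-cong y (admissible-minus X Y u u∉X u∉Y) (dist-deletion X Y u∉X u∉Y))
      (guarded-power-cong y (admissible-⊕⁅⁆ʳ X Y u u∉X u∉Y u∈V) (dist-pivot-deletion X Y u∉X u∉Y)))
      (guarded-power-cong y (admissible-⊕⁅⁆ˡ X Y u u∉X u∉Y u∈V) (dist-dualPivot-deletion X Y u∉X u∉Y))

-- The case without strong divisibility

Degenerate : ∀ {n} → Family n → Fin n → Set
Degenerate g w = Free g w ⊎ Loop g w ⊎ Coloop g w

-- The (X , Y), (X , Y ⊕ ⁅ u ⁆) and (X ⊕ ⁅ u ⁆ , Y) terms of Q₁, without their admissibility guards.
Q₁-group : ∀ {n} → Family n → ℕ → Fin n → Subset n → Subset n → ℕ
Q₁-group g y u X Y =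
  y ^ distᶠ (twist g X Y) + y ^ distᶠ (twist g X (Y ⊕ ⁅ u ⁆)) + y ^ distᶠ (twist g (X ⊕ ⁅ u ⁆) Y)

module _ {n} (v : Subset n) (g g′ : Family n) (y : ℕ) (u : Fin n) (u∈v : lookup v u ≡ true) where

  Q₁-step : (∀ X Y → lookup X u ≡ false → lookup Y u ≡ false →
               Q₁-group g y u X Y ≡ (y + 2) * y ^ distᶠ (twist g′ X Y)) →
    Q₁ (v , g) y ≡ (y + 2) * Q₁ (v - u , g′) y
  Q₁-step group≡ = begin
    Q₁ (v , g) y                                                ≡⟨ Q₁-split v g y u ⟩
    Σ²∌ u (λ X Y → T X Y + T X (Y ⊕ ⁅ u ⁆) + T (X ⊕ ⁅ u ⁆) Y)  ≡⟨ Σ²∌-cong u termwise ⟩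
    Σ²∌ u (λ X Y → (y + 2) * T′ X Y)                            ≡⟨ Σ²∌-* u (y + 2) T′ ⟩
    (y + 2) * Σ²∌ u T′
      ≡⟨ cong ((y + 2) *_) (sym (Q₁-avoiding (v - u) g′ y u (lookup-minus-self v u))) ⟩
    (y + 2) * Q₁ (v - u , g′) y                                 ∎
    where
    open ≡-Reasoning
    T = Q₁-term v g y
    T′ = Q₁-term (v - u) g′ y
    guarded : ∀ {c₁ c₂ c₃ c : Bool} {a b e k} → c₁ ≡ c → c₂ ≡ c → c₃ ≡ c →
      (c ≡ true → y ^ a + y ^ b + y ^ e ≡ (y + 2) * y ^ k) →
      (if c₁ then y ^ a else 0) + (if c₂ then y ^ b else 0) + (if c₃ then y ^ e else 0)
        ≡ (y + 2) * (if c then y ^ k else 0)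
    guarded {c = true} refl refl refl sum≡ = sum≡ refl
    guarded {c = false} refl refl refl _ = sym (*-zeroʳ (y + 2))
    termwise : ∀ X Y → lookup X u ≡ false → lookup Y u ≡ false →
      T X Y + T X (Y ⊕ ⁅ u ⁆) + T (X ⊕ ⁅ u ⁆) Y ≡ (y + 2) * T′ X Y
    termwise X Y u∉X u∉Y =
      guarded {a = distᶠ (twist g X Y)} {distᶠ (twist g X (Y ⊕ ⁅ u ⁆))} {distᶠ (twist g (X ⊕ ⁅ u ⁆) Y)}
              {distᶠ (twist g′ X Y)}
        (admissible-minus X Y u u∉X u∉Y) (admissible-⊕⁅⁆ʳ X Y u u∉X u∉Y u∈v) (admissible-⊕⁅⁆ˡ X Y u u∉X u∉Y u∈v)
        (λ _ → group≡ X Y u∉X u∉Y)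

module _ {n} (g : Family n) (u : Fin n) (nonempty : NonEmpty g) (y : ℕ) (X Y : Subset n)
         (u∉X : lookup X u ≡ false) (u∉Y : lookup Y u ≡ false) where

  private
    N = twist g X Y
    nonempty-N : NonEmpty N
    nonempty-N = twist-stable (NonEmpty-stable u) g X Y u∉X u∉Y nonempty
    powers-cong : ∀ {a b c a′ b′ c′} → a ≡ a′ → b ≡ b′ → c ≡ c′ →
      y ^ a + y ^ b + y ^ c ≡ y ^ a′ + y ^ b′ + y ^ c′
    powers-cong refl refl refl = refl
    dist-right : distᶠ (twist g X (Y ⊕ ⁅ u ⁆)) ≡ distᶠ (pivotD N ⁅ u ⁆)
    dist-right = distᶠ-cong (twist-⊕⁅⁆-right g X u u∉X Y)
    dist-left : distᶠ (twist g (X ⊕ ⁅ u ⁆) Y) ≡ distᶠ (dualPivotᶠ N u)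
    dist-left = distᶠ-cong (twist-⊕⁅⁆-left g X u u∉X Y)
    dist-deleted : distᶠ (twist (delD g u) X Y) ≡ distᶠ (delD N u)
    dist-deleted = distᶠ-cong (twist-delete g X u u∉X Y u∉Y)

  free-group : Free g u → Q₁-group g y u X Y ≡ (y + 2) * y ^ distᶠ (twist (delD g u) X Y)
  free-group free = begin
    Q₁-group g y u X Y
      ≡⟨ powers-cong (sym (free-dist N u nonempty-N free-N))
                     (trans dist-right (trans (free-dist-pivot N u nonempty-N free-N)
                                              (sym (free-dist N u nonempty-N free-N))))
                     (trans dist-left (free-dist-dualPivot N u nonempty-N free-N)) ⟩
    y ^ e + y ^ e + y * y ^ e  ≡⟨ arithmetic y (y ^ e) ⟩
    (y + 2) * y ^ e            ≡⟨ cong (λ k → (y + 2) * y ^ k) (sym dist-deleted) ⟩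
    (y + 2) * y ^ distᶠ (twist (delD g u) X Y) ∎
    where
    open ≡-Reasoning
    free-N = twist-stable (Free-stable u) g X Y u∉X u∉Y free
    e = distᶠ (delD N u)
    arithmetic : ∀ y k → k + k + y * k ≡ (y + 2) * k
    arithmetic = solve-∀

  loop-group : Loop g u → Q₁-group g y u X Y ≡ (y + 2) * y ^ distᶠ (twist (delD g u) X Y)
  loop-group u-loop = begin
    Q₁-group g y u X Y
      ≡⟨ powers-cong {a = e} refl (trans dist-right (loop-dist-pivot N u nonempty-N loop-N))
                                  (trans dist-left (loop-dist-dualPivot N u nonempty-N loop-N)) ⟩
    y ^ e + y * y ^ e + y ^ e  ≡⟨ arithmetic y (y ^ e) ⟩
    (y + 2) * y ^ e
      ≡⟨ cong (λ k → (y + 2) * y ^ k) (sym (trans dist-deleted (distᶠ-cong (delete-loop-≈ N u loop-N)))) ⟩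
    (y + 2) * y ^ distᶠ (twist (delD g u) X Y) ∎
    where
    open ≡-Reasoning
    loop-N = twist-stable (Uniform-stable false u) g X Y u∉X u∉Y u-loop
    e = distᶠ N
    arithmetic : ∀ y k → k + y * k + k ≡ (y + 2) * k
    arithmetic = solve-∀

  coloop-group : Coloop g u → Q₁-group g y u X Y ≡ (y + 2) * y ^ distᶠ (twist (delD (pivotD g ⁅ u ⁆) u) X Y)
  coloop-group u-coloop = begin
    Q₁-group g y u X Y
      ≡⟨ powers-cong (coloop-dist N u nonempty-N coloop-N) dist-right
                     (trans dist-left (coloop-dist-dualPivot N u nonempty-N coloop-N)) ⟩
    y * y ^ e + y ^ e + y ^ e  ≡⟨ arithmetic y (y ^ e) ⟩
    (y + 2) * y ^ e            ≡⟨ cong (λ k → (y + 2) * y ^ k) (sym dist-target) ⟩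
    (y + 2) * y ^ distᶠ (twist (delD (pivotD g ⁅ u ⁆) u) X Y) ∎
    where
    open ≡-Reasoning
    coloop-N = twist-stable (Uniform-stable true u) g X Y u∉X u∉Y u-coloop
    P = pivotD N ⁅ u ⁆
    e = distᶠ P
    dist-target : distᶠ (twist (delD (pivotD g ⁅ u ⁆) u) X Y) ≡ e
    dist-target = distᶠ-cong (≈-trans (twist-delete (pivotD g ⁅ u ⁆) X u u∉X Y u∉Y)
                   (≈-trans (delete-cong (twist-pivot g X u u∉X Y) u) (delete-loop-≈ P u (Coloop-pivot N u coloop-N))))
    arithmetic : ∀ y k → y * k + k + k ≡ (y + 2) * k
    arithmetic = solve-∀

module _ {n} {u w : Fin n} (w≢u : w ≢ u) where

  Uniform-delete : ∀ {b} (g : Family n) → Uniform b g w → Uniform b (delD g u) w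
  Uniform-delete g uniform Z member = uniform Z (∧-conicalˡ (g Z) _ member)

  Degenerate-delete : ∀ (g : Family n) → Degenerate g w → Degenerate (delD g u) w
  Degenerate-delete g (inj₁ free) = inj₁ λ Z → cong₂ (λ a b → a ∧ not b) (free Z) (lookup-⊕⁅⁆-other Z w (≢-sym w≢u))
  Degenerate-delete g (inj₂ (inj₁ w-loop)) = inj₂ (inj₁ (Uniform-delete g w-loop))
  Degenerate-delete g (inj₂ (inj₂ w-coloop)) = inj₂ (inj₂ (Uniform-delete g w-coloop))

  private
    w∉⁅u⁆ : lookup ⁅ u ⁆ w ≡ false
    w∉⁅u⁆ = lookup-⁅⁆-other u w≢u

  Uniform-pivot : ∀ {b} (g : Family n) → Uniform b g w → Uniform b (pivotD g ⁅ u ⁆) w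
  Uniform-pivot {b} g = proj₁ (Uniform-stable b w) g ⁅ u ⁆ w∉⁅u⁆

  Degenerate-pivot : ∀ (g : Family n) → Degenerate g w → Degenerate (pivotD g ⁅ u ⁆) w
  Degenerate-pivot g (inj₁ free) = inj₁ (proj₁ (Free-stable w) g ⁅ u ⁆ w∉⁅u⁆ free)
  Degenerate-pivot g (inj₂ (inj₁ w-loop)) = inj₂ (inj₁ (Uniform-pivot g w-loop))
  Degenerate-pivot g (inj₂ (inj₂ w-coloop)) = inj₂ (inj₂ (Uniform-pivot g w-coloop))

-- The loops outside v say that the members of g lie in v.
DegenerateOn : ∀ {n} → Subset n → Family n → Set
DegenerateOn v g = NonEmpty g × (∀ w → lookup v w ≡ true → Degenerate g w) × (∀ w → lookup v w ≡ false → Loop g w)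

module _ {n} (v : Subset n) (u : Fin n) where

  DegenerateOn-delete : ∀ h → HasMemberAvoiding h u → (∀ w → w ≢ u → lookup v w ≡ true → Degenerate h w) →
    (∀ w → w ≢ u → lookup v w ≡ false → Loop h w) → DegenerateOn (v - u) (delD h u)
  DegenerateOn-delete h avoiding degenerate loops = NonEmpty-delete h u avoiding , degenerate′ , loops′
    where
    degenerate′ : ∀ w → lookup (v - u) w ≡ true → Degenerate (delD h u) w
    degenerate′ w w∈v-u with w ≟ u
    ... | yes refl = ⊥-elim (not-¬ (lookup-minus-self v w) w∈v-u)
    ... | no w≢u = Degenerate-delete w≢u h (degenerate w w≢u (trans (sym (lookup-minus-other v u w≢u)) w∈v-u))
    loops′ : ∀ w → lookup (v - u) w ≡ false → Loop (delD h u) w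
    loops′ w w∉v-u with w ≟ u
    ... | yes refl = Loop-delete h w
    ... | no w≢u = Uniform-delete w≢u h (loops w w≢u (trans (sym (lookup-minus-other v u w≢u)) w∉v-u))

  Q₁-degenerate-step : lookup v u ≡ true → ∀ g → DegenerateOn v g →
    ∃ λ g′ → DegenerateOn (v - u) g′ × ∀ y → Q₁ (v , g) y ≡ (y + 2) * Q₁ (v - u , g′) y
  Q₁-degenerate-step u∈v g (nonempty@(Z , gZ) , degenerate , loops) with degenerate u u∈v
  ... | inj₁ free =
        delD g u ,
        DegenerateOn-delete g (Free-avoiding g u nonempty free) (λ w _ → degenerate w) (λ w _ → loops w) ,
        λ y → Q₁-step v g (delD g u) y u u∈v λ X Y u∉X u∉Y → free-group g u nonempty y X Y u∉X u∉Y free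
  ... | inj₂ (inj₁ u-loop) =
        delD g u ,
        DegenerateOn-delete g (Z , gZ , u-loop Z gZ) (λ w _ → degenerate w) (λ w _ → loops w) ,
        λ y → Q₁-step v g (delD g u) y u u∈v λ X Y u∉X u∉Y → loop-group g u nonempty y X Y u∉X u∉Y u-loop
  ... | inj₂ (inj₂ u-coloop) =
        delD (pivotD g ⁅ u ⁆) u ,
        DegenerateOn-delete (pivotD g ⁅ u ⁆) (Z ⊕ ⁅ u ⁆ , trans (cong g (⊕-cancelʳ Z ⁅ u ⁆)) gZ , ∉-⊕⁅⁆-∈ Z u (u-coloop Z gZ))
          (λ w w≢u w∈v → Degenerate-pivot w≢u g (degenerate w w∈v))
          (λ w w≢u w∉v → Uniform-pivot w≢u g (loops w w∉v)) ,
        λ y → Q₁-step v g (delD (pivotD g ⁅ u ⁆) u) y u u∈v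
                λ X Y u∉X u∉Y → coloop-group g u nonempty y X Y u∉X u∉Y u-coloop

Q₁-degenerate : ∀ {n} k (v : Subset n) g → ∣ v ∣ ≡ k → DegenerateOn v g → ∀ y → Q₁ (v , g) y ≡ (y + 2) ^ k
Q₁-degenerate {n} zero v g ∣v∣≡0 ((Z , gZ) , _ , loops) y =
  subst (λ v′ → Q₁ (v′ , g) y ≡ 1) (sym v≡⊥) (Q₁-⊥ g y (subst (λ T → g T ≡ true) Z≡⊥ gZ))
  where
  v≡⊥ : v ≡ ⊥
  v≡⊥ = subset-ext λ w → trans (card-0 v ∣v∣≡0 w) (sym (lookup-replicate w false))
  Z≡⊥ : Z ≡ ⊥
  Z≡⊥ = subset-ext λ w → trans (loops w (card-0 v ∣v∣≡0 w) Z gZ) (sym (lookup-replicate w false))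
Q₁-degenerate (suc k) v g ∣v∣≡1+k degenerate y with card-suc v ∣v∣≡1+k
... | u , u∈v with Q₁-degenerate-step v u u∈v g degenerate
...   | g′ , degenerate′ , step =
        trans (step y) (cong ((y + 2) *_) (Q₁-degenerate k (v - u) g′ ∣v-u∣≡k degenerate′ y))
  where
  ∣v-u∣≡k : ∣ v - u ∣ ≡ k
  ∣v-u∣≡k = suc-injective
    (trans (cong (λ T → suc ∣ T ∣) (minus-∈ v u u∈v)) (trans (card-⊕⁅⁆-∈ v u u∈v) ∣v∣≡1+k))

module _ {n} (M : SetSystem n) where

  private
    g = D M

  not-divisible⇒uniform : ∀ w → NonEmpty g → ¬ DivisibleBy M w → Loop g w ⊎ Coloop g w
  not-divisible⇒uniform w (Z₀ , gZ₀) not-divisible = case-on-membership Z₀ w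
    (λ w∈Z₀ → inj₂ λ Z gZ → case-on-membership Z w id (λ w∉Z → ⊥-elim (divisible gZ₀ gZ w∈Z₀ w∉Z)))
    (λ w∉Z₀ → inj₁ λ Z gZ → case-on-membership Z w (λ w∈Z → ⊥-elim (divisible gZ gZ₀ w∈Z w∉Z₀)) id)
    where
    divisible : ∀ {Z₁ Z₂} → g Z₁ ≡ true → g Z₂ ≡ true → lookup Z₁ w ≡ true → lookup Z₂ w ≡ false → Empty
    divisible {Z₁} {Z₂} gZ₁ gZ₂ w∈Z₁ w∉Z₂ = not-divisible
      (Z₁ , Z₂ , gZ₁ , gZ₂ , lookup⇒[]= w (Z₁ ⊕ Z₂) (trans (lookup-⊕ Z₁ Z₂ w) (cong₂ _xor_ w∈Z₁ w∉Z₂)))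

  not-strongly-divisible⇒degenerate : VfClosedΔMatroid M → ¬ StronglyDivisible M → DegenerateOn (V M) g
  not-strongly-divisible⇒degenerate vf-closed not-sd = nonempty , degenerate , loops
    where
    nonempty : NonEmpty g
    nonempty = proj₁ (vf-closed [] [])
    loops : ∀ w → lookup (V M) w ≡ false → Loop g w
    loops w w∉V Z gZ = case-on-membership Z w
      (λ w∈Z → ⊥-elim (not-¬ ([]=⇒lookup (D⊆V M Z gZ (lookup⇒[]= w Z w∈Z))) w∉V))
      (λ w∉Z → w∉Z)
    degenerate : ∀ w → lookup (V M) w ≡ true → Degenerate g w
    degenerate w w∈V with anySubset? (λ Z → ¬? (g (Z ⊕ ⁅ w ⁆) Bool.≟ g Z))
    ... | no none = inj₁ λ Z → decidable-stable (g (Z ⊕ ⁅ w ⁆) Bool.≟ g Z) (λ ne → none (Z , ne))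
    ... | yes (Z , ne) = inj₂ (not-divisible⇒uniform w nonempty λ divisible →
                           not-sd (w , lookup⇒[]= w (V M) w∈V , divisible , not-closed))
      where
      not-closed : ∃ λ X → X ∈M M × ¬ ((X ⊕ ⁅ w ⁆) ∈M M)
      not-closed with g Z in gZ
      ... | true = Z , gZ , ne
      ... | false = Z ⊕ ⁅ w ⁆ , ¬-not ne ,
                    λ gZ⊕w⊕w → not-¬ gZ (trans (cong g (sym (⊕-cancelʳ Z ⁅ w ⁆))) gZ⊕w⊕w)

theorem21 : ∀ {n} (M : SetSystem n) → VfClosedΔMatroid M →
    (∀ (u : Fin n) → u ∈ V M → StronglyDivisibleBy M u → ∀ (y : ℕ) →
      Q₁ (raw M) y ≡ Q₁ (raw M ∖ u) y + Q₁ (raw M *ᵖ ⁅ u ⁆ ∖ u) y + Q₁ (raw M *̄ u ∖ u) y)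
    × (¬ StronglyDivisible M → ∀ (y : ℕ) → Q₁ (raw M) y ≡ (y + 2) ^ ∣ V M ∣)
theorem21 M vf-closed =
  (λ u u∈V sd → Q₁-recursion M vf-closed ([]=⇒lookup u∈V) (StronglyDivisibleBy⇒ᶠ M u sd)) ,
  (λ not-sd → Q₁-degenerate _ (V M) (D M) refl (not-strongly-divisible⇒degenerate M vf-closed not-sd))
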